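{- Let $p$ be a prime and $k$ an integer in $[1,p-1]$. For any integers $1\le i\le j\le k$, there exists a circuit $\mathbf{L}$ consisting only of unit-weight edges with $\mathrm{nnz}(\mathbf{L})=O(k)$ whose resistance is congruent modulo $p$ to some integer $w\in[\frac{pi}{j},\frac{pi}{j}+1]$.
   Context: A unit-weight circuit is the Laplacian $\mathbf{L}$ over $\mathbb{Z}_p$ of an undirected unweighted graph on vertices $1,\dots,n$ ($\mathbf{L}_{a,a}=\deg(a)$, $\mathbf{L}_{a,b}=-1$ for edges, $0$ otherwise, mod $p$) such that $\mathrm{SC}(\mathbf{L},\{1,2\})=r(\mathbf{e}_1-\mathbf{e}_2)(\mathbf{e}_1-\mathbf{e}_2)^\top$ for some $r\in\mathbb{Z}_p\setminus\{0\}$, where $\mathrm{SC}(\mathbf{A},T)=\mathbf{A}_{T,T}-\mathbf{A}_{T,S}\mathbf{A}_{S,S}^{ -1}\mathbf{A}_{S,T}$ with $S$ the complement of $T$ (requiring $\mathbf{A}_{S,S}$ invertible). Its weight is $r$ and its resistance is $r^{ -1}$; the resistance is said to be congruent to an integer $w$ if $r^{ -1}\equiv w\pmod p$. -}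

module Defs where

open import Data.Nat as ℕ using (ℕ; zero; suc)
open import Data.Nat.Divisibility as ℕD using (_∣?_)
open import Data.Integer as ℤ using (ℤ; +_; -[1+_]; ∣_∣; _-_; _*_)
open import Data.Integer.Divisibility using () renaming (_∣_ to _∣ℤ_)
open import Data.Fin using (Fin; zero; suc)
open import Data.Bool using (Bool; true; false; if_then_else_)
open import Data.Product using (Σ; _×_; _,_)
open import Relation.Binary.PropositionalEquality using (_≡_)
open import Relation.Nullary using (¬_; yes; no)

sumℕ : ∀ {n} → (Fin n → ℕ) → ℕ
sumℕ {zero}  f = 0
sumℕ {suc n} f = f zero ℕ.+ sumℕ (λ i → f (suc i))

sumℤ : ∀ {n} → (Fin n → ℤ) → ℤ
sumℤ {zero}  f = + 0
sumℤ {suc n} f = f zero ℤ.+ sumℤ (λ i → f (suc i))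

_≡[_]_ : ℤ → ℕ → ℤ → Set
a ≡[ p ] b = (+ p) ∣ℤ (a - b)

record Graph (n : ℕ) : Set where
  field
    adj   : Fin n → Fin n → Bool
    sym   : ∀ a b → adj a b ≡ adj b a
    irrefl : ∀ a → adj a a ≡ false
open Graph public

degree : ∀ {n} → Graph n → Fin n → ℕ
degree G a = sumℕ (λ b → if adj G a b then 1 else 0)

-- Laplacian (integer representatives; interpreted mod p)
laplacian : ∀ {n} → Graph n → Fin n → Fin n → ℤ
laplacian G a b with a Data.Fin.≟ b
... | yes _ = + degree G a
... | no  _ = if adj G a b then -[1+ 0 ] else + 0

nnz : ∀ {n} → ℕ → (Fin n → Fin n → ℤ) → ℕ
nnz p L = sumℕ (λ a → sumℕ (λ b → nz (p ∣? ∣ L a b ∣)))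
  where
  nz : ∀ {P : Set} → Relation.Nullary.Dec P → ℕ
  nz (yes _) = 0
  nz (no  _) = 1

-- Vertices are Fin (2 + m); T = {zero, suc zero} (vertices 1,2), S = the rest.
module _ {m : ℕ} (L : Fin (suc (suc m)) → Fin (suc (suc m)) → ℤ) where
  LSS : Fin m → Fin m → ℤ
  LSS a b = L (suc (suc a)) (suc (suc b))

  emb : Fin 2 → Fin (suc (suc m))
  emb zero = zero
  emb (suc zero) = suc zero

  -- Schur complement onto T, using a given inverse M of L_SS (mod p)
  schur : (Fin m → Fin m → ℤ) → Fin 2 → Fin 2 → ℤ
  schur M t t' = L (emb t) (emb t') -
    sumℤ (λ a → sumℤ (λ b → L (emb t) (suc (suc a)) * M a b * L (suc (suc b)) (emb t')))

idM : ∀ {m} → Fin m → Fin m → ℤ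
idM a b with a Data.Fin.≟ b
... | yes _ = + 1
... | no  _ = + 0

_⊗_ : ∀ {m} → (Fin m → Fin m → ℤ) → (Fin m → Fin m → ℤ) → Fin m → Fin m → ℤ
(A ⊗ B) a b = sumℤ (λ c → A a c * B c b)

IsInverseMod : ℕ → ∀ {m} → (Fin m → Fin m → ℤ) → (Fin m → Fin m → ℤ) → Set
IsInverseMod p A M = (∀ a b → (A ⊗ M) a b ≡[ p ] idM a b) × (∀ a b → (M ⊗ A) a b ≡[ p ] idM a b)

-- (e1 - e2)(e1 - e2)^T
pattern12 : Fin 2 → Fin 2 → ℤ
pattern12 a b with a Data.Fin.≟ b
... | yes _ = + 1
... | no  _ = -[1+ 0 ]

IsCircuitOfWeight : ℕ → ∀ {m} → (Fin (suc (suc m)) → Fin (suc (suc m)) → ℤ) → ℤ → Set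
IsCircuitOfWeight p {m} L r =
  ¬ ((+ p) ∣ℤ r) ×
  Σ (Fin m → Fin m → ℤ) (λ M → IsInverseMod p (LSS L) M ×
     (∀ t t' → schur L M t t' ≡[ p ] (r * pattern12 t t')))

module Submission where

-- A unit edge in series adds 1 to the resistance of a circuit, and two paths of length two in
-- parallel add 2 · ½ = 1 to its conductance.  Running the subtractive Euclidean algorithm on a
-- pair (s, j) backwards from a single edge (s = j) therefore builds a unit-weight circuit of
-- resistance s / j modulo p whose Laplacian has O(s + j) nonzero entries.  Taking
-- w = ⌊p i / j⌋ + 1 and s = w j - p i ∈ [1, j] gives w j ≡ s (mod p), so this circuit has
-- resistance w.  Each construction step adds one interior vertex, and the Schur complement of
-- the new Laplacian is computed from the block inverse of its interior block, which is the old
-- one bordered by a single row and column.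

module SeriesParallelCircuits where

  open import Defs renaming (sym to adj-sym)
  open import Data.Nat as ℕ using (ℕ; zero; suc; _≤_; _<_; _∸_; z≤n; s≤s)
  open import Data.Nat.DivMod using (_/_; _%_; m%n<n; m≡m%n+[m/n]*n)
  import Data.Nat.Properties as ℕ
  open import Data.Nat.Divisibility as ℕ∣ using (_∣?_; _∣0; ∣⇒≤)
  open import Data.Nat.Primality using (Prime)
  open import Data.Nat.Coprimality using (prime⇒coprime; coprime-Bézout)
  import Data.Nat.GCD as GCD
  open import Data.Nat.Tactic.RingSolver using () renaming (solve-∀ to solveℕ)
  open import Data.Integer as ℤ using (ℤ; +_; +0; -1ℤ; _+_; _*_; -_; _-_; ∣_∣)
  import Data.Integer.Properties as ℤ
  open import Data.Integer.Divisibility.Signed as Signed using (divides)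
  open import Data.Integer.Tactic.RingSolver using () renaming (solve-∀ to solveℤ)
  open import Data.Fin using (Fin; zero; suc; _≟_)
  open import Data.Fin.Properties using (suc-injective)
  open import Data.Vec.Functional using (Vector; _∷_)
  open import Data.Bool using (Bool; true; false; if_then_else_)
  open import Data.Product using (Σ-syntax; _×_; _,_; proj₁; proj₂)
  open import Data.Empty using (⊥-elim)
  open import Function using (_∘_)
  open import Induction.WellFounded using (Acc; acc)
  open import Data.Nat.Induction using (<-wellFounded)
  import Algebra.Properties.Semiring.Sum as SemiringSum
  open import Algebra.Bundles using (CommutativeRing)
  open import Algebra.Structures using (IsCommutativeRing)
  open import Relation.Nullary using (¬_; Dec; yes; no)
  open import Relation.Binary.Structures using (IsEquivalence)
  open import Relation.Binary.PropositionalEquality as ≡ using (_≡_; _≢_; refl; cong; cong₂)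
  import Relation.Binary.Reasoning.Setoid as SetoidReasoning

  Matrix : ℕ → Set
  Matrix m = Fin m → Fin m → ℤ

  infixl 7 _*ᵥ_ _ᵥ*_
  infix 6 _·_

  _*ᵥ_ : ∀ {m} → Matrix m → Vector ℤ m → Vector ℤ m
  (M *ᵥ v) a = sumℤ λ b → M a b * v b

  _ᵥ*_ : ∀ {m} → Vector ℤ m → Matrix m → Vector ℤ m
  (u ᵥ* M) b = sumℤ λ a → u a * M a b

  _·_ : ∀ {m} → Vector ℤ m → Vector ℤ m → ℤ
  u · v = sumℤ λ a → u a * v a

  _⟨_⟩_ : ∀ {m} → Vector ℤ m → Matrix m → Vector ℤ m → ℤ
  u ⟨ M ⟩ v = sumℤ λ a → sumℤ λ b → u a * M a b * v b

  0ᵥ : ∀ {m} → Vector ℤ m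
  0ᵥ _ = + 0

  bordered : ∀ {m} → ℤ → Vector ℤ m → Vector ℤ m → Matrix m → Matrix (suc m)
  bordered d u v A zero    zero    = d
  bordered d u v A zero    (suc b) = u b
  bordered d u v A (suc a) zero    = v a
  bordered d u v A (suc a) (suc b) = A a b

  row col : ∀ {m} → Matrix (suc (suc m)) → Fin (suc (suc m)) → Vector ℤ m
  row L x b = L x (suc (suc b))
  col L x a = L (suc (suc a)) x

  -- Vertex 0 is a new terminal joined by a unit edge to the old terminal 0, which becomes the
  -- interior vertex 2; the remaining vertices keep their order.
  seriesLaplacian : ∀ {m} → Matrix (suc (suc m)) → Matrix (suc (suc (suc m)))
  seriesLaplacian L zero          zero          = + 1
  seriesLaplacian L zero          (suc zero)    = + 0
  seriesLaplacian L zero          (suc (suc b)) = (-1ℤ ∷ 0ᵥ) b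
  seriesLaplacian L (suc zero)    zero          = + 0
  seriesLaplacian L (suc zero)    (suc zero)    = L (suc zero) (suc zero)
  seriesLaplacian L (suc zero)    (suc (suc b)) = (L (suc zero) zero ∷ row L (suc zero)) b
  seriesLaplacian L (suc (suc a)) zero          = (-1ℤ ∷ 0ᵥ) a
  seriesLaplacian L (suc (suc a)) (suc zero)    = (L zero (suc zero) ∷ col L (suc zero)) a
  seriesLaplacian L (suc (suc a)) (suc (suc b)) =
    bordered (L zero zero + + 1) (row L zero) (col L zero) (LSS L) a b

  -- Vertex 2 is a new interior vertex joined to both terminals, a path of length two in parallel.
  parallelLaplacian : ∀ {m} → Matrix (suc (suc m)) → Matrix (suc (suc (suc m)))
  parallelLaplacian L zero          zero          = L zero zero + + 1
  parallelLaplacian L zero          (suc zero)    = L zero (suc zero)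
  parallelLaplacian L zero          (suc (suc b)) = (-1ℤ ∷ row L zero) b
  parallelLaplacian L (suc zero)    zero          = L (suc zero) zero
  parallelLaplacian L (suc zero)    (suc zero)    = L (suc zero) (suc zero) + + 1
  parallelLaplacian L (suc zero)    (suc (suc b)) = (-1ℤ ∷ row L (suc zero)) b
  parallelLaplacian L (suc (suc a)) zero          = (-1ℤ ∷ col L zero) a
  parallelLaplacian L (suc (suc a)) (suc zero)    = (-1ℤ ∷ col L (suc zero)) a
  parallelLaplacian L (suc (suc a)) (suc (suc b)) = bordered (+ 2) 0ᵥ 0ᵥ (LSS L) a b

  idM-suc : ∀ {m} (a b : Fin m) → idM (suc a) (suc b) ≡ idM a b
  idM-suc a b with a ≟ b
  ... | yes refl = refl
  ... | no  _    = refl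

  indicator : Bool → ℕ
  indicator b = if b then 1 else 0

  sumℕ-zeros : ∀ n → sumℕ {n} (λ _ → 0) ≡ 0
  sumℕ-zeros zero    = refl
  sumℕ-zeros (suc n) = sumℕ-zeros n

  sumℕ-cong : ∀ {n} {f g : Fin n → ℕ} → (∀ i → f i ≡ g i) → sumℕ f ≡ sumℕ g
  sumℕ-cong {zero}  f≡g = refl
  sumℕ-cong {suc n} f≡g = cong₂ ℕ._+_ (f≡g zero) (sumℕ-cong (λ i → f≡g (suc i)))

  sumℕ-mono : ∀ {n} {f g : Fin n → ℕ} → (∀ i → f i ≤ g i) → sumℕ f ≤ sumℕ g
  sumℕ-mono {zero}  f≤g = z≤n
  sumℕ-mono {suc n} f≤g = ℕ.+-mono-≤ (f≤g zero) (sumℕ-mono (λ i → f≤g (suc i)))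

  laplacian-diagonal : ∀ {n} (G : Graph n) a → laplacian G a a ≡ + degree G a
  laplacian-diagonal G a with a ≟ a
  ... | yes _   = refl
  ... | no  a≢a = ⊥-elim (a≢a refl)

  laplacian-off-diagonal : ∀ {n} (G : Graph n) a b → a ≢ b →
                           laplacian G a b ≡ (if adj G a b then -1ℤ else + 0)
  laplacian-off-diagonal G a b a≢b with a ≟ b
  ... | yes a≡b = ⊥-elim (a≢b a≡b)
  ... | no  _   = refl

  laplacian-transfer-off-diagonal : ∀ {n n'} (H : Graph n') (G : Graph n) x' y' {x y} →
    x' ≢ y' → x ≢ y → adj H x' y' ≡ adj G x y → laplacian H x' y' ≡ laplacian G x y
  laplacian-transfer-off-diagonal H G x' y' {x} {y} x'≢y' x≢y adj≡ =
    ≡.trans (laplacian-off-diagonal H x' y' x'≢y')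
      (≡.trans (cong (λ c → if c then -1ℤ else + 0) adj≡) (≡.sym (laplacian-off-diagonal G x y x≢y)))

  laplacian-transfer-diagonal : ∀ {n n'} (H : Graph n') (G : Graph n) x' x →
    degree H x' ≡ degree G x → laplacian H x' x' ≡ laplacian G x x
  laplacian-transfer-diagonal H G x' x deg≡ =
    ≡.trans (laplacian-diagonal H x') (≡.trans (cong +_ deg≡) (≡.sym (laplacian-diagonal G x)))

  laplacian-transfer-diagonal⁺ : ∀ {n n'} (H : Graph n') (G : Graph n) x' x →
    degree H x' ≡ degree G x ℕ.+ 1 → laplacian H x' x' ≡ laplacian G x x + + 1
  laplacian-transfer-diagonal⁺ H G x' x deg≡ =
    ≡.trans (laplacian-diagonal H x') (≡.trans (cong +_ deg≡) (cong (_+ + 1) (≡.sym (laplacian-diagonal G x))))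

  size : ∀ {n} → Graph n → ℕ
  size G = sumℕ λ a → suc (degree G a)

  -- Defs defines the summand of nnz in a where-block; unification with the refl below names it.
  mutual
    nonzero : ℕ → ∀ {n} → Matrix n → Fin n → Fin n → ℕ
    nonzero = _

    nnz-nonzero : ∀ p {n} (L : Matrix n) → nnz p L ≡ sumℕ (λ a → sumℕ (λ b → nonzero p L a b))
    nnz-nonzero p L = refl

  nonzero≤1 : ∀ p {n} (L : Matrix n) a b → nonzero p L a b ≤ 1
  nonzero≤1 p L a b with p ∣? ∣ L a b ∣
  ... | yes _ = z≤n
  ... | no  _ = s≤s z≤n

  nonzero-zero : ∀ p {n} (L : Matrix n) a b → L a b ≡ + 0 → nonzero p L a b ≡ 0
  nonzero-zero p L a b Lab≡0 with p ∣? ∣ L a b ∣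
  ... | yes _   = refl
  ... | no  p∤0 = ⊥-elim (p∤0 (≡.subst (λ z → p ℕ∣.∣ ∣ z ∣) (≡.sym Lab≡0) (p ∣0)))

  sumℕ-≤-except : ∀ {n} {f g : Fin n → ℕ} a → f a ≤ 1 → (∀ b → a ≢ b → f b ≤ g b) →
                  sumℕ f ≤ suc (sumℕ g)
  sumℕ-≤-except {suc n} {f} {g} zero fa≤1 f≤g =
    ℕ.+-mono-≤ fa≤1 (ℕ.≤-trans (sumℕ-mono (λ b → f≤g (suc b) λ ())) (ℕ.m≤n+m _ (g zero)))
  sumℕ-≤-except {suc n} {f} {g} (suc a) fa≤1 f≤g =
    ℕ.≤-trans
      (ℕ.+-mono-≤ (f≤g zero λ ()) (sumℕ-≤-except a fa≤1 λ b a≢b → f≤g (suc b) (a≢b ∘ suc-injective)))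
      (ℕ.≤-reflexive (ℕ.+-suc (g zero) _))

  nnz≤size : ∀ p {n} (G : Graph n) → nnz p (laplacian G) ≤ size G
  nnz≤size p G = ≡.subst (_≤ size G) (≡.sym (nnz-nonzero p (laplacian G)))
    (sumℕ-mono λ a → sumℕ-≤-except a (nonzero≤1 p (laplacian G) a a)
      λ b a≢b → off-diagonal a b (adj G a b) (laplacian-off-diagonal G a b a≢b))
    where
    off-diagonal : ∀ a b c → laplacian G a b ≡ (if c then -1ℤ else + 0) →
                   nonzero p (laplacian G) a b ≤ indicator c
    off-diagonal a b true  _      = nonzero≤1 p (laplacian G) a b
    off-diagonal a b false Lab≡0 = ℕ.≤-reflexive (nonzero-zero p (laplacian G) a b Lab≡0)

  module _ {m} (G : Graph (suc (suc m))) where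
    private
      A = adj G
      ss : Fin m → Fin (suc (suc m))
      ss a = suc (suc a)

    seriesAdj : Fin (suc (suc (suc m))) → Fin (suc (suc (suc m))) → Bool
    seriesAdj zero                zero                = false
    seriesAdj zero                (suc zero)          = false
    seriesAdj zero                (suc (suc zero))    = true
    seriesAdj zero                (suc (suc (suc b))) = false
    seriesAdj (suc zero)          zero                = false
    seriesAdj (suc zero)          (suc zero)          = A (suc zero) (suc zero)
    seriesAdj (suc zero)          (suc (suc zero))    = A (suc zero) zero
    seriesAdj (suc zero)          (suc (suc (suc b))) = A (suc zero) (ss b)
    seriesAdj (suc (suc zero))    zero                = true
    seriesAdj (suc (suc zero))    (suc zero)          = A zero (suc zero)
    seriesAdj (suc (suc zero))    (suc (suc zero))    = A zero zero
    seriesAdj (suc (suc zero))    (suc (suc (suc b))) = A zero (ss b)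
    seriesAdj (suc (suc (suc a))) zero                = false
    seriesAdj (suc (suc (suc a))) (suc zero)          = A (ss a) (suc zero)
    seriesAdj (suc (suc (suc a))) (suc (suc zero))    = A (ss a) zero
    seriesAdj (suc (suc (suc a))) (suc (suc (suc b))) = A (ss a) (ss b)

    seriesAdj-sym : ∀ x y → seriesAdj x y ≡ seriesAdj y x
    seriesAdj-sym zero                zero                = refl
    seriesAdj-sym zero                (suc zero)          = refl
    seriesAdj-sym zero                (suc (suc zero))    = refl
    seriesAdj-sym zero                (suc (suc (suc b))) = refl
    seriesAdj-sym (suc zero)          zero                = refl
    seriesAdj-sym (suc zero)          (suc zero)          = refl
    seriesAdj-sym (suc zero)          (suc (suc zero))    = adj-sym G _ _
    seriesAdj-sym (suc zero)          (suc (suc (suc b))) = adj-sym G _ _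
    seriesAdj-sym (suc (suc zero))    zero                = refl
    seriesAdj-sym (suc (suc zero))    (suc zero)          = adj-sym G _ _
    seriesAdj-sym (suc (suc zero))    (suc (suc zero))    = refl
    seriesAdj-sym (suc (suc zero))    (suc (suc (suc b))) = adj-sym G _ _
    seriesAdj-sym (suc (suc (suc a))) zero                = refl
    seriesAdj-sym (suc (suc (suc a))) (suc zero)          = adj-sym G _ _
    seriesAdj-sym (suc (suc (suc a))) (suc (suc zero))    = adj-sym G _ _
    seriesAdj-sym (suc (suc (suc a))) (suc (suc (suc b))) = adj-sym G _ _

    seriesAdj-irrefl : ∀ x → seriesAdj x x ≡ false
    seriesAdj-irrefl zero                = refl
    seriesAdj-irrefl (suc zero)          = irrefl G _
    seriesAdj-irrefl (suc (suc zero))    = irrefl G _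
    seriesAdj-irrefl (suc (suc (suc a))) = irrefl G _

    series : Graph (suc (suc (suc m)))
    series = record { adj = seriesAdj ; sym = seriesAdj-sym ; irrefl = seriesAdj-irrefl }

    private
      swap-first : ∀ x y s → x ℕ.+ (y ℕ.+ s) ≡ y ℕ.+ (x ℕ.+ s)
      swap-first = solveℕ

    series-degree₀ : degree series zero ≡ 1
    series-degree₀ = cong suc (sumℕ-zeros m)

    series-degree₁ : degree series (suc zero) ≡ degree G (suc zero)
    series-degree₁ = swap-first (indicator (A (suc zero) (suc zero))) (indicator (A (suc zero) zero)) _

    series-degree₂ : degree series (suc (suc zero)) ≡ degree G zero ℕ.+ 1
    series-degree₂ = ≡.trans (cong suc (swap-first (indicator (A zero (suc zero))) (indicator (A zero zero)) _))
                             (ℕ.+-comm 1 _)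

    series-degree₃ : ∀ a → degree series (suc (suc (suc a))) ≡ degree G (ss a)
    series-degree₃ a = swap-first (indicator (A (ss a) (suc zero))) (indicator (A (ss a) zero)) _

    private
      fresh : ∀ x y → x ≢ y → laplacian series x y ≡ (if seriesAdj x y then -1ℤ else + 0)
      fresh = laplacian-off-diagonal series
      inherited : ∀ x' y' {x y} → x' ≢ y' → x ≢ y → seriesAdj x' y' ≡ A x y →
                  laplacian series x' y' ≡ laplacian G x y
      inherited = laplacian-transfer-off-diagonal series G
      inherited-diagonal : ∀ x' x → degree series x' ≡ degree G x → laplacian series x' x' ≡ laplacian G x x
      inherited-diagonal = laplacian-transfer-diagonal series G
      inherited-diagonal⁺ : ∀ x' x → degree series x' ≡ degree G x ℕ.+ 1 →
                            laplacian series x' x' ≡ laplacian G x x + + 1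
      inherited-diagonal⁺ = laplacian-transfer-diagonal⁺ series G

    laplacian-series : ∀ x y → laplacian series x y ≡ seriesLaplacian (laplacian G) x y
    laplacian-series zero                zero                = ≡.trans (laplacian-diagonal series zero) (cong +_ series-degree₀)
    laplacian-series zero                (suc zero)          = fresh zero (suc zero) (λ ())
    laplacian-series zero                (suc (suc zero))    = fresh zero (suc (suc zero)) (λ ())
    laplacian-series zero                (suc (suc (suc b))) = fresh zero (suc (suc (suc b))) (λ ())
    laplacian-series (suc zero)          zero                = fresh (suc zero) zero (λ ())
    laplacian-series (suc zero)          (suc zero)          = inherited-diagonal (suc zero) (suc zero) series-degree₁
    laplacian-series (suc zero)          (suc (suc zero))    = inherited (suc zero) (suc (suc zero)) (λ ()) (λ ()) refl
    laplacian-series (suc zero)          (suc (suc (suc b))) = inherited (suc zero) (suc (suc (suc b))) (λ ()) (λ ()) refl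
    laplacian-series (suc (suc zero))    zero                = fresh (suc (suc zero)) zero (λ ())
    laplacian-series (suc (suc zero))    (suc zero)          = inherited (suc (suc zero)) (suc zero) (λ ()) (λ ()) refl
    laplacian-series (suc (suc zero))    (suc (suc zero))    = inherited-diagonal⁺ (suc (suc zero)) zero series-degree₂
    laplacian-series (suc (suc zero))    (suc (suc (suc b))) = inherited (suc (suc zero)) (suc (suc (suc b))) (λ ()) (λ ()) refl
    laplacian-series (suc (suc (suc a))) zero                = fresh (suc (suc (suc a))) zero (λ ())
    laplacian-series (suc (suc (suc a))) (suc zero)          = inherited (suc (suc (suc a))) (suc zero) (λ ()) (λ ()) refl
    laplacian-series (suc (suc (suc a))) (suc (suc zero))    = inherited (suc (suc (suc a))) (suc (suc zero)) (λ ()) (λ ()) refl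
    laplacian-series (suc (suc (suc a))) (suc (suc (suc b))) = internal (a ≟ b)
      where
      internal : Dec (a ≡ b) → laplacian series (suc (suc (suc a))) (suc (suc (suc b))) ≡ laplacian G (ss a) (ss b)
      internal (yes refl) = inherited-diagonal (suc (suc (suc a))) (ss a) (series-degree₃ a)
      internal (no a≢b)   = inherited (suc (suc (suc a))) (suc (suc (suc b)))
                              (a≢b ∘ suc-injective ∘ suc-injective ∘ suc-injective)
                              (a≢b ∘ suc-injective ∘ suc-injective) refl

    size-series : size series ≡ 3 ℕ.+ size G
    size-series = ≡.trans
      (cong₂ (λ d₀ s → suc d₀ ℕ.+ s) series-degree₀
        (cong₂ (λ d₁ s → suc d₁ ℕ.+ s) series-degree₁
          (cong₂ (λ d₂ s → suc d₂ ℕ.+ s) series-degree₂ (sumℕ-cong (λ a → cong suc (series-degree₃ a))))))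
      (regroup (degree G zero) (degree G (suc zero)) _)
      where regroup : ∀ x y s → 2 ℕ.+ (suc y ℕ.+ (suc (x ℕ.+ 1) ℕ.+ s)) ≡ 3 ℕ.+ (suc x ℕ.+ (suc y ℕ.+ s))
            regroup = solveℕ

  module _ {m} (G : Graph (suc (suc m))) where
    private
      A = adj G
      ss : Fin m → Fin (suc (suc m))
      ss a = suc (suc a)

    parallelAdj : Fin (suc (suc (suc m))) → Fin (suc (suc (suc m))) → Bool
    parallelAdj zero                zero                = A zero zero
    parallelAdj zero                (suc zero)          = A zero (suc zero)
    parallelAdj zero                (suc (suc zero))    = true
    parallelAdj zero                (suc (suc (suc b))) = A zero (ss b)
    parallelAdj (suc zero)          zero                = A (suc zero) zero
    parallelAdj (suc zero)          (suc zero)          = A (suc zero) (suc zero)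
    parallelAdj (suc zero)          (suc (suc zero))    = true
    parallelAdj (suc zero)          (suc (suc (suc b))) = A (suc zero) (ss b)
    parallelAdj (suc (suc zero))    zero                = true
    parallelAdj (suc (suc zero))    (suc zero)          = true
    parallelAdj (suc (suc zero))    (suc (suc zero))    = false
    parallelAdj (suc (suc zero))    (suc (suc (suc b))) = false
    parallelAdj (suc (suc (suc a))) zero                = A (ss a) zero
    parallelAdj (suc (suc (suc a))) (suc zero)          = A (ss a) (suc zero)
    parallelAdj (suc (suc (suc a))) (suc (suc zero))    = false
    parallelAdj (suc (suc (suc a))) (suc (suc (suc b))) = A (ss a) (ss b)

    parallelAdj-sym : ∀ x y → parallelAdj x y ≡ parallelAdj y x
    parallelAdj-sym zero                zero                = refl
    parallelAdj-sym zero                (suc zero)          = adj-sym G _ _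
    parallelAdj-sym zero                (suc (suc zero))    = refl
    parallelAdj-sym zero                (suc (suc (suc b))) = adj-sym G _ _
    parallelAdj-sym (suc zero)          zero                = adj-sym G _ _
    parallelAdj-sym (suc zero)          (suc zero)          = refl
    parallelAdj-sym (suc zero)          (suc (suc zero))    = refl
    parallelAdj-sym (suc zero)          (suc (suc (suc b))) = adj-sym G _ _
    parallelAdj-sym (suc (suc zero))    zero                = refl
    parallelAdj-sym (suc (suc zero))    (suc zero)          = refl
    parallelAdj-sym (suc (suc zero))    (suc (suc zero))    = refl
    parallelAdj-sym (suc (suc zero))    (suc (suc (suc b))) = refl
    parallelAdj-sym (suc (suc (suc a))) zero                = adj-sym G _ _
    parallelAdj-sym (suc (suc (suc a))) (suc zero)          = adj-sym G _ _
    parallelAdj-sym (suc (suc (suc a))) (suc (suc zero))    = refl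
    parallelAdj-sym (suc (suc (suc a))) (suc (suc (suc b))) = adj-sym G _ _

    parallelAdj-irrefl : ∀ x → parallelAdj x x ≡ false
    parallelAdj-irrefl zero                = irrefl G _
    parallelAdj-irrefl (suc zero)          = irrefl G _
    parallelAdj-irrefl (suc (suc zero))    = refl
    parallelAdj-irrefl (suc (suc (suc a))) = irrefl G _

    parallel : Graph (suc (suc (suc m)))
    parallel = record { adj = parallelAdj ; sym = parallelAdj-sym ; irrefl = parallelAdj-irrefl }

    private
      add-middle : ∀ x y s → x ℕ.+ (y ℕ.+ (1 ℕ.+ s)) ≡ x ℕ.+ (y ℕ.+ s) ℕ.+ 1
      add-middle = solveℕ

    parallel-degree₀ : degree parallel zero ≡ degree G zero ℕ.+ 1
    parallel-degree₀ = add-middle (indicator (A zero zero)) (indicator (A zero (suc zero))) _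

    parallel-degree₁ : degree parallel (suc zero) ≡ degree G (suc zero) ℕ.+ 1
    parallel-degree₁ = add-middle (indicator (A (suc zero) zero)) (indicator (A (suc zero) (suc zero))) _

    parallel-degree₂ : degree parallel (suc (suc zero)) ≡ 2
    parallel-degree₂ = cong (2 ℕ.+_) (sumℕ-zeros m)

    parallel-degree₃ : ∀ a → degree parallel (suc (suc (suc a))) ≡ degree G (ss a)
    parallel-degree₃ a = refl

    private
      fresh : ∀ x y → x ≢ y → laplacian parallel x y ≡ (if parallelAdj x y then -1ℤ else + 0)
      fresh = laplacian-off-diagonal parallel
      inherited : ∀ x' y' {x y} → x' ≢ y' → x ≢ y → parallelAdj x' y' ≡ A x y →
                  laplacian parallel x' y' ≡ laplacian G x y
      inherited = laplacian-transfer-off-diagonal parallel G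
      inherited-diagonal : ∀ x' x → degree parallel x' ≡ degree G x → laplacian parallel x' x' ≡ laplacian G x x
      inherited-diagonal = laplacian-transfer-diagonal parallel G
      inherited-diagonal⁺ : ∀ x' x → degree parallel x' ≡ degree G x ℕ.+ 1 →
                            laplacian parallel x' x' ≡ laplacian G x x + + 1
      inherited-diagonal⁺ = laplacian-transfer-diagonal⁺ parallel G

    laplacian-parallel : ∀ x y → laplacian parallel x y ≡ parallelLaplacian (laplacian G) x y
    laplacian-parallel zero                zero                = inherited-diagonal⁺ zero zero parallel-degree₀
    laplacian-parallel zero                (suc zero)          = inherited zero (suc zero) (λ ()) (λ ()) refl
    laplacian-parallel zero                (suc (suc zero))    = fresh zero (suc (suc zero)) (λ ())
    laplacian-parallel zero                (suc (suc (suc b))) = inherited zero (suc (suc (suc b))) (λ ()) (λ ()) refl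
    laplacian-parallel (suc zero)          zero                = inherited (suc zero) zero (λ ()) (λ ()) refl
    laplacian-parallel (suc zero)          (suc zero)          = inherited-diagonal⁺ (suc zero) (suc zero) parallel-degree₁
    laplacian-parallel (suc zero)          (suc (suc zero))    = fresh (suc zero) (suc (suc zero)) (λ ())
    laplacian-parallel (suc zero)          (suc (suc (suc b))) = inherited (suc zero) (suc (suc (suc b))) (λ ()) (λ ()) refl
    laplacian-parallel (suc (suc zero))    zero                = fresh (suc (suc zero)) zero (λ ())
    laplacian-parallel (suc (suc zero))    (suc zero)          = fresh (suc (suc zero)) (suc zero) (λ ())
    laplacian-parallel (suc (suc zero))    (suc (suc zero))    =
      ≡.trans (laplacian-diagonal parallel (suc (suc zero))) (cong +_ parallel-degree₂)
    laplacian-parallel (suc (suc zero))    (suc (suc (suc b))) = fresh (suc (suc zero)) (suc (suc (suc b))) (λ ())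
    laplacian-parallel (suc (suc (suc a))) zero                = inherited (suc (suc (suc a))) zero (λ ()) (λ ()) refl
    laplacian-parallel (suc (suc (suc a))) (suc zero)          = inherited (suc (suc (suc a))) (suc zero) (λ ()) (λ ()) refl
    laplacian-parallel (suc (suc (suc a))) (suc (suc zero))    = fresh (suc (suc (suc a))) (suc (suc zero)) (λ ())
    laplacian-parallel (suc (suc (suc a))) (suc (suc (suc b))) = internal (a ≟ b)
      where
      internal : Dec (a ≡ b) → laplacian parallel (suc (suc (suc a))) (suc (suc (suc b))) ≡ laplacian G (ss a) (ss b)
      internal (yes refl) = inherited-diagonal (suc (suc (suc a))) (ss a) (parallel-degree₃ a)
      internal (no a≢b)   = inherited (suc (suc (suc a))) (suc (suc (suc b)))
                              (a≢b ∘ suc-injective ∘ suc-injective ∘ suc-injective)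
                              (a≢b ∘ suc-injective ∘ suc-injective) refl

    size-parallel : size parallel ≡ 5 ℕ.+ size G
    size-parallel = ≡.trans
      (cong₂ (λ d₀ s → suc d₀ ℕ.+ s) parallel-degree₀
        (cong₂ (λ d₁ s → suc d₁ ℕ.+ s) parallel-degree₁
          (cong (λ d₂ → suc d₂ ℕ.+ rest) parallel-degree₂)))
      (regroup (degree G zero) (degree G (suc zero)) rest)
      where rest = sumℕ λ a → suc (degree G (ss a))
            regroup : ∀ x y s → suc (x ℕ.+ 1) ℕ.+ (suc (y ℕ.+ 1) ℕ.+ (3 ℕ.+ s)) ≡ 5 ℕ.+ (suc x ℕ.+ (suc y ℕ.+ s))
            regroup = solveℕ

  edge : Graph 2
  edge = record { adj = adjacent ; sym = adjacent-sym ; irrefl = adjacent-irrefl }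
    where
    adjacent : Fin 2 → Fin 2 → Bool
    adjacent zero       zero       = false
    adjacent zero       (suc zero) = true
    adjacent (suc zero) zero       = true
    adjacent (suc zero) (suc zero) = false

    adjacent-sym : ∀ x y → adjacent x y ≡ adjacent y x
    adjacent-sym zero       zero       = refl
    adjacent-sym zero       (suc zero) = refl
    adjacent-sym (suc zero) zero       = refl
    adjacent-sym (suc zero) (suc zero) = refl

    adjacent-irrefl : ∀ x → adjacent x x ≡ false
    adjacent-irrefl zero       = refl
    adjacent-irrefl (suc zero) = refl

  ≤∸1⇒< : ∀ {m n} → 1 ≤ m → m ≤ n ∸ 1 → m < n
  ≤∸1⇒< {n = zero}  1≤m m≤0 = ⊥-elim (ℕ.<⇒≱ 1≤m m≤0)
  ≤∸1⇒< {n = suc n} _   m≤n = s≤s m≤n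

  size-growth : ∀ {c x y} → c ≤ 10 → 1 ≤ y → c ℕ.+ 10 ℕ.* x ≤ 10 ℕ.* (x ℕ.+ y)
  size-growth {c} {x} {y} c≤10 1≤y = begin
    c ℕ.+ 10 ℕ.* x   ≤⟨ ℕ.+-monoˡ-≤ (10 ℕ.* x) c≤10 ⟩
    10 ℕ.+ 10 ℕ.* x  ≡⟨ ℕ.*-suc 10 x ⟨
    10 ℕ.* suc x     ≤⟨ ℕ.*-monoʳ-≤ 10 (ℕ.≤-trans (ℕ.≤-reflexive (ℕ.+-comm 1 x)) (ℕ.+-monoʳ-≤ x 1≤y)) ⟩
    10 ℕ.* (x ℕ.+ y) ∎
    where open ℕ.≤-Reasoning

  size-budget : ∀ {s j k} → s ≤ j → j ≤ k → 10 ℕ.* (s ℕ.+ j) ≤ 20 ℕ.* k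
  size-budget {s} {j} {k} s≤j j≤k = begin
    10 ℕ.* (s ℕ.+ j) ≤⟨ ℕ.*-monoʳ-≤ 10 (ℕ.+-monoˡ-≤ j s≤j) ⟩
    10 ℕ.* (j ℕ.+ j) ≡⟨ double j ⟩
    20 ℕ.* j         ≤⟨ ℕ.*-monoʳ-≤ 20 j≤k ⟩
    20 ℕ.* k         ∎
    where open ℕ.≤-Reasoning
          double : ∀ j → 10 ℕ.* (j ℕ.+ j) ≡ 20 ℕ.* j
          double = solveℕ

  next-multiple : ∀ n j → 1 ≤ j → Σ[ w ∈ ℕ ] Σ[ s ∈ ℕ ] w ℕ.* j ≡ n ℕ.+ s × 1 ≤ s × s ≤ j
  next-multiple n j@(suc _) _ =
    suc (n / j) , j ∸ n % j , wj≡n+s , ℕ.m<n⇒0<n∸m (m%n<n n j) , ℕ.m∸n≤m j (n % j)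
    where
    open ≡.≡-Reasoning
    wj≡n+s : suc (n / j) ℕ.* j ≡ n ℕ.+ (j ∸ n % j)
    wj≡n+s = begin
      j ℕ.+ n / j ℕ.* j
        ≡⟨ cong (ℕ._+ n / j ℕ.* j) (ℕ.m+[n∸m]≡n (ℕ.<⇒≤ (m%n<n n j))) ⟨
      n % j ℕ.+ (j ∸ n % j) ℕ.+ n / j ℕ.* j ≡⟨ swap (n % j) (j ∸ n % j) (n / j ℕ.* j) ⟩
      n % j ℕ.+ n / j ℕ.* j ℕ.+ (j ∸ n % j) ≡⟨ cong (ℕ._+ (j ∸ n % j)) (m≡m%n+[m/n]*n n j) ⟨
      n ℕ.+ (j ∸ n % j)                     ∎
      where swap : ∀ a b c → a ℕ.+ b ℕ.+ c ≡ a ℕ.+ c ℕ.+ b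
            swap = solveℕ

  -- Linear algebra modulo p

  module Modular (p : ℕ) where

    infix 4 _≈_
    -- A record rather than the divisibility statement itself, so that a and b can be inferred.
    record _≈_ (a b : ℤ) : Set where
      constructor mk≈
      field modulus∣difference : + p Signed.∣ a - b

    ≡⇒≈ : ∀ {a b} → a ≡ b → a ≈ b
    ≡⇒≈ {a} refl = mk≈ (divides +0 (ℤ.+-inverseʳ a))

    private
      ∣-resp : ∀ {x y} → x ≡ y → + p Signed.∣ x → + p Signed.∣ y
      ∣-resp = ≡.subst (+ p Signed.∣_)

      identity-sym : ∀ a b → - (a - b) ≡ b - a
      identity-sym = solveℤ
      identity-trans : ∀ a b c → (a - b) + (b - c) ≡ a - c
      identity-trans = solveℤ
      identity-+ : ∀ a b c d → (a - b) + (c - d) ≡ (a + c) - (b + d)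
      identity-+ = solveℤ
      identity-* : ∀ a b c d → c * (a - b) + b * (c - d) ≡ a * c - b * d
      identity-* = solveℤ
      identity-neg : ∀ a b → - (a - b) ≡ - a - - b
      identity-neg = solveℤ

    ≈-isEquivalence : IsEquivalence _≈_
    ≈-isEquivalence = record
      { refl  = ≡⇒≈ refl
      ; sym   = λ {a} {b} (mk≈ d) → mk≈ (∣-resp (identity-sym a b) (Signed.∣m⇒∣-m d))
      ; trans = λ {a} {b} {c} (mk≈ d) (mk≈ e) →
                  mk≈ (∣-resp (identity-trans a b c) (Signed.∣m∣n⇒∣m+n d e))
      }

    +-cong : ∀ {a b c d} → a ≈ b → c ≈ d → a + c ≈ b + d
    +-cong {a} {b} {c} {d} (mk≈ e) (mk≈ f) =
      mk≈ (∣-resp (identity-+ a b c d) (Signed.∣m∣n⇒∣m+n e f))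

    *-cong : ∀ {a b c d} → a ≈ b → c ≈ d → a * c ≈ b * d
    *-cong {a} {b} {c} {d} (mk≈ e) (mk≈ f) =
      mk≈ (∣-resp (identity-* a b c d) (Signed.∣m∣n⇒∣m+n (Signed.∣n⇒∣m*n c e) (Signed.∣n⇒∣m*n b f)))

    -‿cong : ∀ {a b} → a ≈ b → - a ≈ - b
    -‿cong {a} {b} (mk≈ e) = mk≈ (∣-resp (identity-neg a b) (Signed.∣m⇒∣-m e))

    ≈-isCommutativeRing : IsCommutativeRing _≈_ _+_ _*_ -_ (+ 0) (+ 1)
    ≈-isCommutativeRing = record
      { isRing = record
        { +-isAbelianGroup = record
          { isGroup = record
            { isMonoid = record
              { isSemigroup = record
                { isMagma = record { isEquivalence = ≈-isEquivalence ; ∙-cong = +-cong }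
                ; assoc = λ a b c → ≡⇒≈ (ℤ.+-assoc a b c) }
              ; identity = (λ a → ≡⇒≈ (ℤ.+-identityˡ a)) , (λ a → ≡⇒≈ (ℤ.+-identityʳ a)) }
            ; inverse = (λ a → ≡⇒≈ (ℤ.+-inverseˡ a)) , (λ a → ≡⇒≈ (ℤ.+-inverseʳ a))
            ; ⁻¹-cong = -‿cong }
          ; comm = λ a b → ≡⇒≈ (ℤ.+-comm a b) }
        ; *-cong = *-cong
        ; *-assoc = λ a b c → ≡⇒≈ (ℤ.*-assoc a b c)
        ; *-identity = (λ a → ≡⇒≈ (ℤ.*-identityˡ a)) , (λ a → ≡⇒≈ (ℤ.*-identityʳ a))
        ; distrib = (λ a b c → ≡⇒≈ (ℤ.*-distribˡ-+ a b c)) , (λ a b c → ≡⇒≈ (ℤ.*-distribʳ-+ a b c)) }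
      ; *-comm = λ a b → ≡⇒≈ (ℤ.*-comm a b)
      }

    ℤ/p : CommutativeRing _ _
    ℤ/p = record { isCommutativeRing = ≈-isCommutativeRing }

    open CommutativeRing ℤ/p public using (setoid; semiring; +-congˡ; +-congʳ; *-congˡ; *-congʳ)
      renaming (refl to ≈-refl; sym to ≈-sym; trans to ≈-trans)

    open SetoidReasoning setoid
    open SemiringSum semiring
      using (sum; sum-cong-≋; sum-cong-≗; sum-replicate-zero; ∑-distrib-+; ∑-comm; *-distribˡ-sum; *-distribʳ-sum)

    sumℤ≡sum : ∀ {n} (f : Fin n → ℤ) → sumℤ f ≡ sum f
    sumℤ≡sum {zero}  f = refl
    sumℤ≡sum {suc n} f = cong (λ s → f zero + s) (sumℤ≡sum (f ∘ suc))

    sumℤ-cong : ∀ {n} {f g : Fin n → ℤ} → (∀ i → f i ≈ g i) → sumℤ f ≈ sumℤ g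
    sumℤ-cong {f = f} {g} f≈g = begin
      sumℤ f ≡⟨ sumℤ≡sum f ⟩
      sum f  ≈⟨ sum-cong-≋ f≈g ⟩
      sum g  ≡⟨ sumℤ≡sum g ⟨
      sumℤ g ∎

    sumℤ-zero : ∀ {n} (f : Fin n → ℤ) → (∀ i → f i ≈ + 0) → sumℤ f ≈ + 0
    sumℤ-zero {n} f f≈0 = begin
      sumℤ f             ≈⟨ sumℤ-cong f≈0 ⟩
      sumℤ {n} 0ᵥ   ≡⟨ sumℤ≡sum {n} 0ᵥ ⟩
      sum {n} 0ᵥ    ≈⟨ sum-replicate-zero n ⟩
      + 0                ∎

    sumℤ-distrib-+ : ∀ {n} (f g : Fin n → ℤ) → sumℤ (λ i → f i + g i) ≈ sumℤ f + sumℤ g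
    sumℤ-distrib-+ f g = begin
      sumℤ (λ i → f i + g i) ≡⟨ sumℤ≡sum (λ i → f i + g i) ⟩
      sum (λ i → f i + g i)  ≈⟨ ∑-distrib-+ f g ⟩
      sum f + sum g          ≡⟨ cong₂ _+_ (sumℤ≡sum f) (sumℤ≡sum g) ⟨
      sumℤ f + sumℤ g        ∎

    *-distribˡ-sumℤ : ∀ {n} c (f : Fin n → ℤ) → c * sumℤ f ≈ sumℤ (λ i → c * f i)
    *-distribˡ-sumℤ c f = begin
      c * sumℤ f             ≡⟨ cong (c *_) (sumℤ≡sum f) ⟩
      c * sum f              ≈⟨ *-distribˡ-sum c f ⟩
      sum (λ i → c * f i)    ≡⟨ sumℤ≡sum (λ i → c * f i) ⟨
      sumℤ (λ i → c * f i)   ∎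

    *-distribʳ-sumℤ : ∀ {n} c (f : Fin n → ℤ) → sumℤ f * c ≈ sumℤ (λ i → f i * c)
    *-distribʳ-sumℤ c f = begin
      sumℤ f * c             ≡⟨ cong (_* c) (sumℤ≡sum f) ⟩
      sum f * c              ≈⟨ *-distribʳ-sum c f ⟩
      sum (λ i → f i * c)    ≡⟨ sumℤ≡sum (λ i → f i * c) ⟨
      sumℤ (λ i → f i * c)   ∎

    sumℤ-comm : ∀ {m n} (f : Fin m → Fin n → ℤ) →
                sumℤ (λ i → sumℤ (λ j → f i j)) ≈ sumℤ (λ j → sumℤ (λ i → f i j))
    sumℤ-comm f = begin
      sumℤ (λ i → sumℤ (f i))               ≡⟨ sumℤ≡sum (λ i → sumℤ (f i)) ⟩
      sum (λ i → sumℤ (f i))                ≡⟨ sum-cong-≗ (λ i → sumℤ≡sum (f i)) ⟩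
      sum (λ i → sum (f i))                 ≈⟨ ∑-comm f ⟩
      sum (λ j → sum (λ i → f i j))         ≡⟨ sum-cong-≗ (λ j → sumℤ≡sum (λ i → f i j)) ⟨
      sum (λ j → sumℤ (λ i → f i j))        ≡⟨ sumℤ≡sum (λ j → sumℤ (λ i → f i j)) ⟨
      sumℤ (λ j → sumℤ (λ i → f i j))       ∎

    IsInverse : ∀ {m} → Matrix m → Matrix m → Set
    IsInverse A M = (∀ a b → (A ⊗ M) a b ≈ idM a b) × (∀ a b → (M ⊗ A) a b ≈ idM a b)

    ⟨⟩≈·*ᵥ : ∀ {m} (u : Vector ℤ m) M v → u ⟨ M ⟩ v ≈ u · M *ᵥ v
    ⟨⟩≈·*ᵥ u M v = sumℤ-cong λ a → begin
      sumℤ (λ b → u a * M a b * v b)   ≈⟨ sumℤ-cong (λ b → ≡⇒≈ (assoc (u a) (M a b) (v b))) ⟩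
      sumℤ (λ b → u a * (M a b * v b)) ≈⟨ *-distribˡ-sumℤ (u a) (λ b → M a b * v b) ⟨
      u a * (M *ᵥ v) a                 ∎
      where assoc : ∀ x y z → x * y * z ≡ x * (y * z)
            assoc = solveℤ

    ⟨⟩≈ᵥ*· : ∀ {m} (u : Vector ℤ m) M v → u ⟨ M ⟩ v ≈ u ᵥ* M · v
    ⟨⟩≈ᵥ*· u M v = begin
      u ⟨ M ⟩ v                                   ≈⟨ sumℤ-comm (λ a b → u a * M a b * v b) ⟩
      sumℤ (λ b → sumℤ (λ a → u a * M a b * v b))
        ≈⟨ sumℤ-cong (λ b → *-distribʳ-sumℤ (v b) (λ a → u a * M a b)) ⟨
      u ᵥ* M · v                                  ∎

    ⟨⟩-zeroˡ : ∀ {m} (M : Matrix m) v → 0ᵥ ⟨ M ⟩ v ≈ + 0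
    ⟨⟩-zeroˡ M v = sumℤ-zero _ (λ a → sumℤ-zero (λ b → + 0 * M a b * v b) (λ b → ≈-refl))

    ⟨⟩-zeroʳ : ∀ {m} u (M : Matrix m) → u ⟨ M ⟩ 0ᵥ ≈ + 0
    ⟨⟩-zeroʳ u M = sumℤ-zero _ (λ a → sumℤ-zero _ (λ b → ≡⇒≈ (ℤ.*-zeroʳ (u a * M a b))))

    *ᵥ-⊗ : ∀ {m} (A M : Matrix m) v a → (A *ᵥ (M *ᵥ v)) a ≈ ((A ⊗ M) *ᵥ v) a
    *ᵥ-⊗ A M v a = ≈-trans (≈-sym (⟨⟩≈·*ᵥ (A a) M v)) (⟨⟩≈ᵥ*· (A a) M v)

    ᵥ*-⊗ : ∀ {m} u (M A : Matrix m) b → (u ᵥ* M ᵥ* A) b ≈ (u ᵥ* (M ⊗ A)) b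
    ᵥ*-⊗ u M A b = ≈-trans (≈-sym (⟨⟩≈ᵥ*· u M (λ c → A c b))) (⟨⟩≈·*ᵥ u M (λ c → A c b))

    idM-*ᵥ : ∀ {m} (v : Vector ℤ m) a → (idM *ᵥ v) a ≈ v a
    idM-*ᵥ v zero = begin
      + 1 * v zero + sumℤ (λ e → + 0 * v (suc e))
        ≈⟨ +-cong (≡⇒≈ (ℤ.*-identityˡ (v zero))) (sumℤ-zero (λ e → + 0 * v (suc e)) λ _ → ≈-refl) ⟩
      v zero + + 0                                ≡⟨ ℤ.+-identityʳ (v zero) ⟩
      v zero                                      ∎
    idM-*ᵥ v (suc a) = begin
      + 0 * v zero + sumℤ (λ e → idM (suc a) (suc e) * v (suc e))
        ≈⟨ +-cong (≡⇒≈ (ℤ.*-zeroˡ (v zero))) (sumℤ-cong (λ e → ≡⇒≈ (cong (_* v (suc e)) (idM-suc a e)))) ⟩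
      + 0 + (idM *ᵥ (v ∘ suc)) a  ≡⟨ ℤ.+-identityˡ _ ⟩
      (idM *ᵥ (v ∘ suc)) a        ≈⟨ idM-*ᵥ (v ∘ suc) a ⟩
      v (suc a)                   ∎

    ᵥ*-idM : ∀ {m} (u : Vector ℤ m) b → (u ᵥ* idM) b ≈ u b
    ᵥ*-idM u zero = begin
      u zero * + 1 + sumℤ (λ e → u (suc e) * + 0)
        ≈⟨ +-cong (≡⇒≈ (ℤ.*-identityʳ (u zero)))
                  (sumℤ-zero (λ e → u (suc e) * + 0) λ e → ≡⇒≈ (ℤ.*-zeroʳ (u (suc e)))) ⟩
      u zero + + 0                                ≡⟨ ℤ.+-identityʳ (u zero) ⟩
      u zero                                      ∎
    ᵥ*-idM u (suc b) = begin
      u zero * + 0 + sumℤ (λ e → u (suc e) * idM (suc e) (suc b))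
        ≈⟨ +-cong (≡⇒≈ (ℤ.*-zeroʳ (u zero))) (sumℤ-cong (λ e → ≡⇒≈ (cong (u (suc e) *_) (idM-suc e b)))) ⟩
      + 0 + ((u ∘ suc) ᵥ* idM) b  ≡⟨ ℤ.+-identityˡ _ ⟩
      ((u ∘ suc) ᵥ* idM) b        ≈⟨ ᵥ*-idM (u ∘ suc) b ⟩
      u (suc b)                   ∎

    *ᵥ-inverse : ∀ {m} {A M : Matrix m} → (∀ a b → (A ⊗ M) a b ≈ idM a b) →
                 ∀ v a → (A *ᵥ (M *ᵥ v)) a ≈ v a
    *ᵥ-inverse {A = A} {M} A⊗M≈I v a = begin
      (A *ᵥ (M *ᵥ v)) a   ≈⟨ *ᵥ-⊗ A M v a ⟩
      ((A ⊗ M) *ᵥ v) a    ≈⟨ sumℤ-cong (λ e → *-cong (A⊗M≈I a e) ≈-refl) ⟩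
      (idM *ᵥ v) a        ≈⟨ idM-*ᵥ v a ⟩
      v a                 ∎

    ᵥ*-inverse : ∀ {m} {M A : Matrix m} → (∀ a b → (M ⊗ A) a b ≈ idM a b) →
                 ∀ u b → (u ᵥ* M ᵥ* A) b ≈ u b
    ᵥ*-inverse {M = M} {A} M⊗A≈I u b = begin
      (u ᵥ* M ᵥ* A) b     ≈⟨ ᵥ*-⊗ u M A b ⟩
      (u ᵥ* (M ⊗ A)) b    ≈⟨ sumℤ-cong (λ e → *-cong (≈-refl {u e}) (M⊗A≈I e b)) ⟩
      (u ᵥ* idM) b        ≈⟨ ᵥ*-idM u b ⟩
      u b                 ∎

    sumℤ-factor : ∀ {n} {f g : Vector ℤ n} k → (∀ c → f c ≈ k * g c) → sumℤ f ≈ k * sumℤ g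
    sumℤ-factor {g = g} k f≈kg = ≈-trans (sumℤ-cong f≈kg) (≈-sym (*-distribˡ-sumℤ k g))

    sumℤ-split : ∀ {n} {f g h : Vector ℤ n} k → (∀ c → f c ≈ g c + k * h c) → sumℤ f ≈ sumℤ g + k * sumℤ h
    sumℤ-split {g = g} {h} k f≈g+kh = ≈-trans (sumℤ-cong f≈g+kh)
      (≈-trans (sumℤ-distrib-+ g (λ c → k * h c)) (+-congˡ {sumℤ g} (≈-sym (*-distribˡ-sumℤ k h))))

    *-≈0 : ∀ k {z} → z ≈ + 0 → k * z ≈ + 0
    *-≈0 k z≈0 = ≈-trans (*-congˡ {k} z≈0) (≡⇒≈ (ℤ.*-zeroʳ k))

    -≈0 : ∀ {a b} → a ≈ b → a - b ≈ + 0
    -≈0 {b = b} a≈b = ≈-trans (+-congʳ { - b} a≈b) (≡⇒≈ (ℤ.+-inverseʳ b))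

    minus-≈0 : ∀ x {z} → z ≈ + 0 → x - z ≈ x
    minus-≈0 x z≈0 = ≈-trans (+-congˡ {x} (-‿cong z≈0)) (≡⇒≈ (ℤ.+-identityʳ x))

    absorb : ∀ {e} t c {z} → e ≈ t + c * z → z ≈ + 0 → e ≈ t
    absorb t c e≈t+cz z≈0 = ≈-trans e≈t+cz (≈-trans (+-congˡ {t} (*-≈0 c z≈0)) (≡⇒≈ (ℤ.+-identityʳ t)))

    -- The inverse of [[d, u], [v, A]] obtained by eliminating A, i.e. through the Schur
    -- complement d - u A⁻¹ v, whose inverse modulo p is τ.
    module Bordered {m} (d : ℤ) (u v : Vector ℤ m) {A M : Matrix m} (A⁻¹ : IsInverse A M)
                    (τ : ℤ) (τ-inv : τ * (d - u ⟨ M ⟩ v) ≈ + 1) where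

      x y : Vector ℤ m
      x = M *ᵥ v
      y = u ᵥ* M

      inverse : Matrix (suc m)
      inverse = bordered τ (λ b → - (τ * y b)) (λ a → - (τ * x a)) (λ a b → M a b + τ * x a * y b)

      private
        B N : Matrix (suc m)
        B = bordered d u v A
        N = inverse

        defect≈0 : + 1 - τ * (d - u ⟨ M ⟩ v) ≈ + 0
        defect≈0 = -≈0 (≈-sym τ-inv)

        u·x≈ : u · x ≈ u ⟨ M ⟩ v
        u·x≈ = ≈-sym (⟨⟩≈·*ᵥ u M v)

        y·v≈ : y · v ≈ u ⟨ M ⟩ v
        y·v≈ = ≈-sym (⟨⟩≈ᵥ*· u M v)

        Ax≈v : ∀ a → (A *ᵥ x) a ≈ v a
        Ax≈v = *ᵥ-inverse {A = A} {M} (proj₁ A⁻¹) v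

        yA≈u : ∀ b → (y ᵥ* A) b ≈ u b
        yA≈u = ᵥ*-inverse {M = M} {A} (proj₂ A⁻¹) u

      B⊗N≈I : ∀ α β → (B ⊗ N) α β ≈ idM α β
      B⊗N≈I zero zero = begin
        d * τ + sumℤ (λ c → u c * - (τ * x c))
          ≈⟨ +-congˡ {d * τ} (sumℤ-factor (- τ) λ c → ≡⇒≈ (regroup (u c) τ (x c))) ⟩
        d * τ + - τ * (u · x)                  ≈⟨ +-congˡ {d * τ} (*-congˡ { - τ} u·x≈) ⟩
        d * τ + - τ * (u ⟨ M ⟩ v)              ≡⟨ collect d τ (u ⟨ M ⟩ v) ⟩
        τ * (d - u ⟨ M ⟩ v)                    ≈⟨ τ-inv ⟩
        + 1                                    ∎
        where
        regroup : ∀ a t b → a * - (t * b) ≡ - t * (a * b)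
        regroup = solveℤ
        collect : ∀ d t q → d * t + - t * q ≡ t * (d - q)
        collect = solveℤ
      B⊗N≈I zero (suc b) = begin
        d * - (τ * y b) + sumℤ (λ c → u c * (M c b + τ * x c * y b))
          ≈⟨ +-congˡ {d * - (τ * y b)}
               (sumℤ-split (τ * y b) λ c → ≡⇒≈ (regroup (u c) (M c b) τ (x c) (y b))) ⟩
        d * - (τ * y b) + (y b + τ * y b * (u · x))
          ≈⟨ +-congˡ {d * - (τ * y b)} (+-congˡ {y b} (*-congˡ {τ * y b} u·x≈)) ⟩
        d * - (τ * y b) + (y b + τ * y b * (u ⟨ M ⟩ v)) ≡⟨ collect d τ (y b) (u ⟨ M ⟩ v) ⟩
        y b * (+ 1 - τ * (d - u ⟨ M ⟩ v))               ≈⟨ *-≈0 (y b) defect≈0 ⟩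
        + 0                                             ∎
        where
        regroup : ∀ a m t x' y' → a * (m + t * x' * y') ≡ a * m + t * y' * (a * x')
        regroup = solveℤ
        collect : ∀ d t y' q → d * - (t * y') + (y' + t * y' * q) ≡ y' * (+ 1 - t * (d - q))
        collect = solveℤ
      B⊗N≈I (suc a) zero = begin
        v a * τ + sumℤ (λ c → A a c * - (τ * x c))
          ≈⟨ +-congˡ {v a * τ} (sumℤ-factor (- τ) λ c → ≡⇒≈ (regroup (A a c) τ (x c))) ⟩
        v a * τ + - τ * (A *ᵥ x) a ≡⟨ collect (v a) τ ((A *ᵥ x) a) ⟩
        τ * (v a - (A *ᵥ x) a)     ≈⟨ *-≈0 τ (-≈0 (≈-sym (Ax≈v a))) ⟩
        + 0                        ∎
        where
        regroup : ∀ a t b → a * - (t * b) ≡ - t * (a * b)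
        regroup = solveℤ
        collect : ∀ w t z → w * t + - t * z ≡ t * (w - z)
        collect = solveℤ
      B⊗N≈I (suc a) (suc b) = begin
        v a * - (τ * y b) + sumℤ (λ c → A a c * (M c b + τ * x c * y b))
          ≈⟨ +-congˡ {v a * - (τ * y b)}
               (sumℤ-split (τ * y b) λ c → ≡⇒≈ (regroup (A a c) (M c b) τ (x c) (y b))) ⟩
        v a * - (τ * y b) + ((A ⊗ M) a b + τ * y b * (A *ᵥ x) a)
          ≡⟨ collect (v a) τ (y b) ((A ⊗ M) a b) ((A *ᵥ x) a) ⟩
        (A ⊗ M) a b + τ * y b * ((A *ᵥ x) a - v a)
          ≈⟨ +-cong (proj₁ A⁻¹ a b) (*-≈0 (τ * y b) (-≈0 (Ax≈v a))) ⟩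
        idM a b + + 0                              ≡⟨ ℤ.+-identityʳ (idM a b) ⟩
        idM a b                                    ≡⟨ idM-suc a b ⟨
        idM (suc a) (suc b)                        ∎
        where
        regroup : ∀ a m t x' y' → a * (m + t * x' * y') ≡ a * m + t * y' * (a * x')
        regroup = solveℤ
        collect : ∀ w t y' s z → w * - (t * y') + (s + t * y' * z) ≡ s + t * y' * (z - w)
        collect = solveℤ

      N⊗B≈I : ∀ α β → (N ⊗ B) α β ≈ idM α β
      N⊗B≈I zero zero = begin
        τ * d + sumℤ (λ c → - (τ * y c) * v c)
          ≈⟨ +-congˡ {τ * d} (sumℤ-factor (- τ) λ c → ≡⇒≈ (regroup (y c) τ (v c))) ⟩
        τ * d + - τ * (y · v)                  ≈⟨ +-congˡ {τ * d} (*-congˡ { - τ} y·v≈) ⟩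
        τ * d + - τ * (u ⟨ M ⟩ v)              ≡⟨ collect d τ (u ⟨ M ⟩ v) ⟩
        τ * (d - u ⟨ M ⟩ v)                    ≈⟨ τ-inv ⟩
        + 1                                    ∎
        where
        regroup : ∀ a t b → - (t * a) * b ≡ - t * (a * b)
        regroup = solveℤ
        collect : ∀ d t q → t * d + - t * q ≡ t * (d - q)
        collect = solveℤ
      N⊗B≈I zero (suc b) = begin
        τ * u b + sumℤ (λ c → - (τ * y c) * A c b)
          ≈⟨ +-congˡ {τ * u b} (sumℤ-factor (- τ) λ c → ≡⇒≈ (regroup (y c) τ (A c b))) ⟩
        τ * u b + - τ * (y ᵥ* A) b ≡⟨ collect (u b) τ ((y ᵥ* A) b) ⟩
        τ * (u b - (y ᵥ* A) b)     ≈⟨ *-≈0 τ (-≈0 (≈-sym (yA≈u b))) ⟩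
        + 0                        ∎
        where
        regroup : ∀ a t b → - (t * a) * b ≡ - t * (a * b)
        regroup = solveℤ
        collect : ∀ w t z → t * w + - t * z ≡ t * (w - z)
        collect = solveℤ
      N⊗B≈I (suc a) zero = begin
        - (τ * x a) * d + sumℤ (λ c → (M a c + τ * x a * y c) * v c)
          ≈⟨ +-congˡ { - (τ * x a) * d}
               (sumℤ-split (τ * x a) λ c → ≡⇒≈ (regroup (M a c) τ (x a) (y c) (v c))) ⟩
        - (τ * x a) * d + (x a + τ * x a * (y · v))
          ≈⟨ +-congˡ { - (τ * x a) * d} (+-congˡ {x a} (*-congˡ {τ * x a} y·v≈)) ⟩
        - (τ * x a) * d + (x a + τ * x a * (u ⟨ M ⟩ v)) ≡⟨ collect d τ (x a) (u ⟨ M ⟩ v) ⟩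
        x a * (+ 1 - τ * (d - u ⟨ M ⟩ v))               ≈⟨ *-≈0 (x a) defect≈0 ⟩
        + 0                                             ∎
        where
        regroup : ∀ m t x' y' w → (m + t * x' * y') * w ≡ m * w + t * x' * (y' * w)
        regroup = solveℤ
        collect : ∀ d t x' q → - (t * x') * d + (x' + t * x' * q) ≡ x' * (+ 1 - t * (d - q))
        collect = solveℤ
      N⊗B≈I (suc a) (suc b) = begin
        - (τ * x a) * u b + sumℤ (λ c → (M a c + τ * x a * y c) * A c b)
          ≈⟨ +-congˡ { - (τ * x a) * u b}
               (sumℤ-split (τ * x a) λ c → ≡⇒≈ (regroup (M a c) τ (x a) (y c) (A c b))) ⟩
        - (τ * x a) * u b + ((M ⊗ A) a b + τ * x a * (y ᵥ* A) b)
          ≡⟨ collect (u b) τ (x a) ((M ⊗ A) a b) ((y ᵥ* A) b) ⟩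
        (M ⊗ A) a b + τ * x a * ((y ᵥ* A) b - u b)
          ≈⟨ +-cong (proj₂ A⁻¹ a b) (*-≈0 (τ * x a) (-≈0 (yA≈u b))) ⟩
        idM a b + + 0                              ≡⟨ ℤ.+-identityʳ (idM a b) ⟩
        idM a b                                    ≡⟨ idM-suc a b ⟨
        idM (suc a) (suc b)                        ∎
        where
        regroup : ∀ m t x' y' w → (m + t * x' * y') * w ≡ m * w + t * x' * (y' * w)
        regroup = solveℤ
        collect : ∀ w t x' s z → - (t * x') * w + (s + t * x' * z) ≡ s + t * x' * (z - w)
        collect = solveℤ

      isInverse : IsInverse B N
      isInverse = B⊗N≈I , N⊗B≈I

      inverse-form : Vector ℤ (suc m) → Vector ℤ (suc m) → ℤ
      inverse-form g h =
        τ * (g zero - (g ∘ suc) ⟨ M ⟩ v) * (h zero - u ⟨ M ⟩ (h ∘ suc)) + (g ∘ suc) ⟨ M ⟩ (h ∘ suc)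

      bilinear-form : ∀ g h → g ⟨ N ⟩ h ≈ inverse-form g h
      bilinear-form g h = begin
        (g₀ * τ * h₀ + sumℤ (λ b → g₀ * - (τ * y b) * H b))
          + sumℤ (λ a → G a * - (τ * x a) * h₀ + sumℤ (λ b → G a * (M a b + τ * x a * y b) * H b))
            ≈⟨ +-cong (+-congˡ {g₀ * τ * h₀}
                        (sumℤ-factor (- (τ * g₀)) λ b → ≡⇒≈ (regroup₀ g₀ τ (y b) (H b))))
                      (sumℤ-split k summand) ⟩
        (g₀ * τ * h₀ + - (τ * g₀) * (y · H)) + (G ⟨ M ⟩ H + k * (G · x))
            ≈⟨ +-cong (+-congˡ {g₀ * τ * h₀} (*-congˡ { - (τ * g₀)} y·H≈))
                      (+-congˡ {G ⟨ M ⟩ H} (*-cong (*-congˡ {τ} (+-congʳ { - h₀} y·H≈)) G·x≈)) ⟩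
        (g₀ * τ * h₀ + - (τ * g₀) * (u ⟨ M ⟩ H)) + (G ⟨ M ⟩ H + τ * (u ⟨ M ⟩ H - h₀) * (G ⟨ M ⟩ v))
            ≡⟨ collect g₀ h₀ τ (u ⟨ M ⟩ H) (G ⟨ M ⟩ v) (G ⟨ M ⟩ H) ⟩
        τ * (g₀ - G ⟨ M ⟩ v) * (h₀ - u ⟨ M ⟩ H) + G ⟨ M ⟩ H ∎
        where
        g₀ = g zero
        h₀ = h zero
        G = g ∘ suc
        H = h ∘ suc
        k = τ * ((y · H) - h₀)

        y·H≈ : y · H ≈ u ⟨ M ⟩ H
        y·H≈ = ≈-sym (⟨⟩≈ᵥ*· u M H)
        G·x≈ : G · x ≈ G ⟨ M ⟩ v
        G·x≈ = ≈-sym (⟨⟩≈·*ᵥ G M v)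

        regroup₀ : ∀ g t y' h' → g * - (t * y') * h' ≡ - (t * g) * (y' * h')
        regroup₀ = solveℤ
        regroup : ∀ g m t x' y' h' → g * (m + t * x' * y') * h' ≡ g * m * h' + t * g * x' * (y' * h')
        regroup = solveℤ
        collect-row : ∀ g x' t h₀ s q →
                      g * - (t * x') * h₀ + (s + t * g * x' * q) ≡ s + t * (q - h₀) * (g * x')
        collect-row = solveℤ
        collect : ∀ g₀ h₀ t Q P R →
                  (g₀ * t * h₀ + - (t * g₀) * Q) + (R + t * (Q - h₀) * P) ≡ t * (g₀ - P) * (h₀ - Q) + R
        collect = solveℤ

        summand : ∀ a → G a * - (τ * x a) * h₀ + sumℤ (λ b → G a * (M a b + τ * x a * y b) * H b)
                    ≈ sumℤ (λ b → G a * M a b * H b) + k * (G a * x a)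
        summand a = begin
          G a * - (τ * x a) * h₀ + sumℤ (λ b → G a * (M a b + τ * x a * y b) * H b)
            ≈⟨ +-congˡ {G a * - (τ * x a) * h₀}
                 (sumℤ-split (τ * G a * x a) λ b → ≡⇒≈ (regroup (G a) (M a b) τ (x a) (y b) (H b))) ⟩
          G a * - (τ * x a) * h₀ + (sumℤ (λ b → G a * M a b * H b) + τ * G a * x a * (y · H))
            ≡⟨ collect-row (G a) (x a) τ h₀ (sumℤ (λ b → G a * M a b * H b)) (y · H) ⟩
          sumℤ (λ b → G a * M a b * H b) + k * (G a * x a) ∎

      schur-inverse : ∀ (L : Matrix (suc (suc (suc m)))) t t' → schur L inverse t t' ≈
        L (emb L t) (emb L t') - inverse-form (λ α → L (emb L t) (suc (suc α))) (λ β → L (suc (suc β)) (emb L t'))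
      schur-inverse L t t' = +-congˡ {L (emb L t) (emb L t')}
        (-‿cong (bilinear-form (λ α → L (emb L t) (suc (suc α))) (λ β → L (suc (suc β)) (emb L t'))))

    -- Circuits

    record Circuit {m} (L : Matrix (suc (suc m))) (r : ℤ) : Set where
      constructor circuit
      field
        interiorInverse : Matrix m
        isInverse       : IsInverse (LSS L) interiorInverse
        schur≈          : ∀ t t' → schur L interiorInverse t t' ≈ r * pattern12 t t'

    form-cong : ∀ ℓ τ {a a' b b' c c'} → a ≈ a' → b ≈ b' → c ≈ c' →
                ℓ - (τ * a * b + c) ≈ ℓ - (τ * a' * b' + c')
    form-cong ℓ τ a≈ b≈ c≈ = +-congˡ {ℓ} (-‿cong (+-cong (*-cong (*-congˡ {τ} a≈) b≈) c≈))

    series-circuit : ∀ {m} {L : Matrix (suc (suc m))} {r} τ → τ * (r + + 1) ≈ + 1 →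
                     Circuit L r → Circuit (seriesLaplacian L) (τ * r)
    series-circuit {L = L} {r} τ τ-inv (circuit M M-inv sc) = circuit inverse isInverse sc′
      where
      q = row L zero ⟨ M ⟩ col L zero

      d-q≈r+1 : L zero zero + + 1 - q ≈ r + + 1
      d-q≈r+1 = begin
        L zero zero + + 1 - q   ≡⟨ shuffle (L zero zero) q ⟩
        (L zero zero - q) + + 1 ≈⟨ +-congʳ {+ 1} (sc zero zero) ⟩
        r * + 1 + + 1           ≡⟨ cong (_+ + 1) (ℤ.*-identityʳ r) ⟩
        r + + 1                 ∎
        where shuffle : ∀ l q → l + + 1 - q ≡ (l - q) + + 1
              shuffle = solveℤ

      open Bordered (L zero zero + + 1) (row L zero) (col L zero) {LSS L} {M} M-inv τ
                    (≈-trans (*-congˡ {τ} d-q≈r+1) τ-inv)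

      defect≈0 : + 1 - τ * (r + + 1) ≈ + 0
      defect≈0 = -≈0 (≈-sym τ-inv)

      sc′ : ∀ t t' → schur (seriesLaplacian L) inverse t t' ≈ τ * r * pattern12 t t'
      sc′ zero zero = begin
        schur (seriesLaplacian L) inverse zero zero ≈⟨ schur-inverse (seriesLaplacian L) zero zero ⟩
        + 1 - (τ * (-1ℤ - 0ᵥ ⟨ M ⟩ col L zero) * (-1ℤ - row L zero ⟨ M ⟩ 0ᵥ) + 0ᵥ ⟨ M ⟩ 0ᵥ)
          ≈⟨ form-cong (+ 1) τ (minus-≈0 -1ℤ (⟨⟩-zeroˡ M (col L zero))) (minus-≈0 -1ℤ (⟨⟩-zeroʳ (row L zero) M))
                       (⟨⟩-zeroˡ M 0ᵥ) ⟩
        + 1 - (τ * -1ℤ * -1ℤ + + 0) ≈⟨ absorb (τ * r * + 1) (+ 1) (≡⇒≈ (solve₀ τ r)) defect≈0 ⟩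
        τ * r * + 1 ∎
        where solve₀ : ∀ τ r → + 1 - (τ * -1ℤ * -1ℤ + + 0) ≡ τ * r * + 1 + + 1 * (+ 1 - τ * (r + + 1))
              solve₀ = solveℤ
      sc′ zero (suc zero) = begin
        schur (seriesLaplacian L) inverse zero (suc zero)
          ≈⟨ schur-inverse (seriesLaplacian L) zero (suc zero) ⟩
        + 0 - (τ * (-1ℤ - 0ᵥ ⟨ M ⟩ col L zero) * schur L M zero (suc zero) + 0ᵥ ⟨ M ⟩ col L (suc zero))
          ≈⟨ form-cong (+ 0) τ (minus-≈0 -1ℤ (⟨⟩-zeroˡ M (col L zero))) (sc zero (suc zero))
                       (⟨⟩-zeroˡ M (col L (suc zero))) ⟩
        + 0 - (τ * -1ℤ * (r * -1ℤ) + + 0) ≡⟨ solve₀₁ τ r ⟩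
        τ * r * -1ℤ ∎
        where solve₀₁ : ∀ τ r → + 0 - (τ * -1ℤ * (r * -1ℤ) + + 0) ≡ τ * r * -1ℤ
              solve₀₁ = solveℤ
      sc′ (suc zero) zero = begin
        schur (seriesLaplacian L) inverse (suc zero) zero
          ≈⟨ schur-inverse (seriesLaplacian L) (suc zero) zero ⟩
        + 0 - (τ * schur L M (suc zero) zero * (-1ℤ - row L zero ⟨ M ⟩ 0ᵥ) + row L (suc zero) ⟨ M ⟩ 0ᵥ)
          ≈⟨ form-cong (+ 0) τ (sc (suc zero) zero) (minus-≈0 -1ℤ (⟨⟩-zeroʳ (row L zero) M))
                       (⟨⟩-zeroʳ (row L (suc zero)) M) ⟩
        + 0 - (τ * (r * -1ℤ) * -1ℤ + + 0) ≡⟨ solve₁₀ τ r ⟩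
        τ * r * -1ℤ ∎
        where solve₁₀ : ∀ τ r → + 0 - (τ * (r * -1ℤ) * -1ℤ + + 0) ≡ τ * r * -1ℤ
              solve₁₀ = solveℤ
      sc′ (suc zero) (suc zero) = begin
        schur (seriesLaplacian L) inverse (suc zero) (suc zero)
          ≈⟨ schur-inverse (seriesLaplacian L) (suc zero) (suc zero) ⟩
        L (suc zero) (suc zero) - (τ * schur L M (suc zero) zero * schur L M zero (suc zero) + R)
          ≡⟨ regroup (L (suc zero) (suc zero)) τ (schur L M (suc zero) zero) (schur L M zero (suc zero)) R ⟩
        schur L M (suc zero) (suc zero) - τ * schur L M (suc zero) zero * schur L M zero (suc zero)
          ≈⟨ +-cong (sc (suc zero) (suc zero))
                    (-‿cong (*-cong (*-congˡ {τ} (sc (suc zero) zero)) (sc zero (suc zero)))) ⟩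
        r * + 1 - τ * (r * -1ℤ) * (r * -1ℤ) ≈⟨ absorb (τ * r * + 1) r (≡⇒≈ (solve₁₁ τ r)) defect≈0 ⟩
        τ * r * + 1 ∎
        where R = row L (suc zero) ⟨ M ⟩ col L (suc zero)
              regroup : ∀ l τ a b c → l - (τ * a * b + c) ≡ (l - c) - τ * a * b
              regroup = solveℤ
              solve₁₁ : ∀ τ r →
                        r * + 1 - τ * (r * -1ℤ) * (r * -1ℤ) ≡ τ * r * + 1 + r * (+ 1 - τ * (r + + 1))
              solve₁₁ = solveℤ
      sc′ zero (suc (suc ()))
      sc′ (suc zero) (suc (suc ()))
      sc′ (suc (suc ())) _

    parallel-circuit : ∀ {m} {L : Matrix (suc (suc m))} {r} η → η * + 2 ≈ + 1 →
                       Circuit L r → Circuit (parallelLaplacian L) (r + η)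
    parallel-circuit {m} {L} {r} η η-inv (circuit M M-inv sc) = circuit inverse isInverse sc′
      where
      open Bordered {m} (+ 2) 0ᵥ 0ᵥ {LSS L} {M} M-inv η
                    (≈-trans (*-congˡ {η} (minus-≈0 (+ 2) (⟨⟩-zeroˡ M 0ᵥ))) η-inv)

      defect≈0 : + 1 - η * + 2 ≈ + 0
      defect≈0 = -≈0 (≈-sym η-inv)

      R : Fin 2 → Fin 2 → ℤ
      R t t' = row L (emb L t) ⟨ M ⟩ col L (emb L t')

      zeros : ∀ ℓ x y →
              ℓ - (η * (-1ℤ - row L x ⟨ M ⟩ 0ᵥ) * (-1ℤ - 0ᵥ ⟨ M ⟩ col L y) + row L x ⟨ M ⟩ col L y)
                ≈ ℓ - (η * -1ℤ * -1ℤ + row L x ⟨ M ⟩ col L y)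
      zeros ℓ x y =
        form-cong ℓ η (minus-≈0 -1ℤ (⟨⟩-zeroʳ (row L x) M)) (minus-≈0 -1ℤ (⟨⟩-zeroˡ M (col L y))) ≈-refl

      diagonal : ∀ ℓ R → ℓ - R ≈ r * + 1 → (ℓ + + 1) - (η * -1ℤ * -1ℤ + R) ≈ (r + η) * + 1
      diagonal ℓ R ℓ-R≈r = begin
        (ℓ + + 1) - (η * -1ℤ * -1ℤ + R) ≡⟨ regroup ℓ R η ⟩
        (ℓ - R) + + 1 - η                ≈⟨ +-congʳ { - η} (+-congʳ {+ 1} ℓ-R≈r) ⟩
        r * + 1 + + 1 - η                ≈⟨ absorb ((r + η) * + 1) (+ 1) (≡⇒≈ (solve₀ r η)) defect≈0 ⟩
        (r + η) * + 1                    ∎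
        where regroup : ∀ ℓ R η → (ℓ + + 1) - (η * -1ℤ * -1ℤ + R) ≡ (ℓ - R) + + 1 - η
              regroup = solveℤ
              solve₀ : ∀ r η → r * + 1 + + 1 - η ≡ (r + η) * + 1 + + 1 * (+ 1 - η * + 2)
              solve₀ = solveℤ

      off-diagonal : ∀ ℓ R → ℓ - R ≈ r * -1ℤ → ℓ - (η * -1ℤ * -1ℤ + R) ≈ (r + η) * -1ℤ
      off-diagonal ℓ R ℓ-R≈-r = begin
        ℓ - (η * -1ℤ * -1ℤ + R) ≡⟨ regroup ℓ R η ⟩
        (ℓ - R) - η              ≈⟨ +-congʳ { - η} ℓ-R≈-r ⟩
        r * -1ℤ - η              ≡⟨ solve₀ r η ⟩
        (r + η) * -1ℤ            ∎
        where regroup : ∀ ℓ R η → ℓ - (η * -1ℤ * -1ℤ + R) ≡ (ℓ - R) - η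
              regroup = solveℤ
              solve₀ : ∀ r η → r * -1ℤ - η ≡ (r + η) * -1ℤ
              solve₀ = solveℤ

      sc′ : ∀ t t' → schur (parallelLaplacian L) inverse t t' ≈ (r + η) * pattern12 t t'
      sc′ zero zero = ≈-trans (schur-inverse (parallelLaplacian L) zero zero)
        (≈-trans (zeros (L zero zero + + 1) zero zero)
                 (diagonal (L zero zero) (R zero zero) (sc zero zero)))
      sc′ zero (suc zero) = ≈-trans (schur-inverse (parallelLaplacian L) zero (suc zero))
        (≈-trans (zeros (L zero (suc zero)) zero (suc zero))
                 (off-diagonal (L zero (suc zero)) (R zero (suc zero)) (sc zero (suc zero))))
      sc′ (suc zero) zero = ≈-trans (schur-inverse (parallelLaplacian L) (suc zero) zero)
        (≈-trans (zeros (L (suc zero) zero) (suc zero) zero)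
                 (off-diagonal (L (suc zero) zero) (R (suc zero) zero) (sc (suc zero) zero)))
      sc′ (suc zero) (suc zero) = ≈-trans (schur-inverse (parallelLaplacian L) (suc zero) (suc zero))
        (≈-trans (zeros (L (suc zero) (suc zero) + + 1) (suc zero) (suc zero))
                 (diagonal (L (suc zero) (suc zero)) (R (suc zero) (suc zero)) (sc (suc zero) (suc zero))))
      sc′ zero (suc (suc ()))
      sc′ (suc zero) (suc (suc ()))
      sc′ (suc (suc ())) _

    Circuit-resp : ∀ {m} {L₁ L₂ : Matrix (suc (suc m))} {r} →
                   (∀ x y → L₁ x y ≡ L₂ x y) → Circuit L₂ r → Circuit L₁ r
    Circuit-resp {L₁ = L₁} {L₂} L₁≡L₂ (circuit M (AM≈I , MA≈I) sc) = circuit M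
      ((λ a b → ≈-trans (sumℤ-cong λ c → ≡⇒≈ (cong (_* M c b) (L₁≡L₂ _ _))) (AM≈I a b)) ,
       (λ a b → ≈-trans (sumℤ-cong λ c → ≡⇒≈ (cong (M a c *_) (L₁≡L₂ _ _))) (MA≈I a b)))
      λ t t' → ≈-trans (+-cong (≡⇒≈ (L₁≡L₂ _ _)) (-‿cong (sumℤ-cong λ a → sumℤ-cong λ b →
                 ≡⇒≈ (cong₂ (λ x y → x * M a b * y) (L₁≡L₂ _ _) (L₁≡L₂ _ _))))) (sc t t')

    edge-circuit : Circuit (laplacian edge) (+ 1)
    edge-circuit = circuit (λ ()) ((λ ()) , (λ ())) schur≈
      where
      schur≈ : ∀ t t' → schur (laplacian edge) (λ ()) t t' ≈ + 1 * pattern12 t t'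
      schur≈ zero       zero       = ≈-refl
      schur≈ zero       (suc zero) = ≈-refl
      schur≈ (suc zero) zero       = ≈-refl
      schur≈ (suc zero) (suc zero) = ≈-refl

    ≈⇒≡[p] : ∀ {a b} → a ≈ b → a ≡[ p ] b
    ≈⇒≡[p] (mk≈ p∣a-b) = Signed.∣⇒∣ᵤ p∣a-b

    circuit⇒isCircuitOfWeight : ∀ {m} {L : Matrix (suc (suc m))} {r} →
                                ¬ (r ≈ + 0) → Circuit L r → IsCircuitOfWeight p L r
    circuit⇒isCircuitOfWeight {r = r} r≉0 (circuit M (AM≈I , MA≈I) sc) =
      (λ p∣r → r≉0 (mk≈ (≡.subst (+ p Signed.∣_) (≡.sym (ℤ.+-identityʳ r)) (Signed.∣ᵤ⇒∣ p∣r)))) ,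
      M , ((λ a b → ≈⇒≡[p] (AM≈I a b)) , (λ a b → ≈⇒≡[p] (MA≈I a b))) ,
      λ t t' → ≈⇒≡[p] (sc t t')

    p≈0 : + p ≈ + 0
    p≈0 = mk≈ (divides (+ 1) (≡.trans (ℤ.+-identityʳ (+ p)) (≡.sym (ℤ.*-identityˡ (+ p)))))

    small-≉0 : ∀ {n} → 0 < n → n < p → ¬ (+ n ≈ + 0)
    small-≉0 {suc n} _ n<p (mk≈ p∣n-0) =
      ℕ.<⇒≱ n<p (∣⇒≤ (Signed.∣⇒∣ᵤ (≡.subst (+ p Signed.∣_) (ℤ.+-identityʳ (+ suc n)) p∣n-0)))

    weight-≉0 : ∀ {r s j} → r * + s ≈ + j → 0 < j → j < p → ¬ (r ≈ + 0)
    weight-≉0 {r} {s} rs≈j 0<j j<p r≈0 = small-≉0 0<j j<p (begin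
      + _       ≈⟨ ≈-sym rs≈j ⟩
      r * + s   ≈⟨ *-congʳ {+ s} r≈0 ⟩
      + 0 * + s ≡⟨ ℤ.*-zeroˡ (+ s) ⟩
      + 0       ∎)

    -- weight * a ≈ b: the circuit has resistance a / b modulo p.
    record ResistanceCircuit (a b : ℕ) : Set where
      field
        {internal} : ℕ
        graph      : Graph (suc (suc internal))
        weight     : ℤ
        isCircuit  : Circuit (laplacian graph) weight
        resistance : weight * + a ≈ + b
        small      : size graph ≤ 10 ℕ.* (a ℕ.+ b)

    unit-edge : ∀ {a} → 1 ≤ a → ResistanceCircuit a a
    unit-edge {a} 1≤a = record
      { graph = edge ; weight = + 1 ; isCircuit = edge-circuit
      ; resistance = ≡⇒≈ (ℤ.*-identityˡ (+ a))
      ; small = ℕ.≤-trans (ℕ.m≤m+n 4 6) (ℕ.*-monoʳ-≤ 10 (ℕ.≤-trans 1≤a (ℕ.m≤m+n a a))) }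

    private
      lift : ∀ a b c d → 1 ℕ.+ a ℕ.* b ≡ c ℕ.* d → + 1 + + a * + b ≡ + c * + d
      lift a b c d eq = ≡.trans (cong (λ z → + 1 + z) (≡.sym (ℤ.pos-* a b))) (≡.trans (cong +_ eq) (ℤ.pos-* c d))

    module _ (p-prime : Prime p) where

      small-invertible : ∀ {n} → 0 < n → n < p → Σ[ σ ∈ ℤ ] σ * + n ≈ + 1
      small-invertible {suc n} _ n<p with coprime-Bézout (prime⇒coprime p-prime n<p)
      ... | GCD.Bézout.+- x y 1+yn≡xp = - + y , (begin
        - + y * + suc n             ≡⟨ rearrange (+ y) (+ suc n) ⟩
        + 1 - (+ 1 + + y * + suc n) ≡⟨ cong (λ z → + 1 - z) (lift y (suc n) x p 1+yn≡xp) ⟩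
        + 1 - + x * + p             ≈⟨ +-congˡ {+ 1} (-‿cong (*-congˡ {+ x} p≈0)) ⟩
        + 1 - + x * + 0             ≡⟨ vanish (+ x) ⟩
        + 1                         ∎)
        where rearrange : ∀ y n → - y * n ≡ + 1 - (+ 1 + y * n)
              rearrange = solveℤ
              vanish : ∀ x → + 1 - x * + 0 ≡ + 1
              vanish = solveℤ
      ... | GCD.Bézout.-+ x y 1+xp≡yn = + y , (begin
        + y * + suc n     ≡⟨ lift x p y (suc n) 1+xp≡yn ⟨
        + 1 + + x * + p   ≈⟨ +-congˡ {+ 1} (*-congˡ {+ x} p≈0) ⟩
        + 1 + + x * + 0   ≡⟨ vanish (+ x) ⟩
        + 1               ∎)
        where vanish : ∀ x → + 1 + x * + 0 ≡ + 1
              vanish = solveℤ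

      series-step : ∀ {a b} → 1 ≤ b → a ℕ.+ b < p → ResistanceCircuit a b → ResistanceCircuit (a ℕ.+ b) b
      series-step {a} {b} 1≤b a+b<p C = record
        { graph = series graph ; weight = τ * weight
        ; isCircuit = Circuit-resp (laplacian-series graph) (series-circuit τ τ-inv isCircuit)
        ; resistance = begin
            σ * + a * weight * (+ a + + b)   ≡⟨ regroup σ (+ a) weight (+ b) ⟩
            σ * (+ a + + b) * (weight * + a) ≈⟨ *-congˡ {σ * (+ a + + b)} resistance ⟩
            σ * (+ a + + b) * + b            ≈⟨ *-congʳ {+ b} σ-inv ⟩
            + 1 * + b                        ≡⟨ ℤ.*-identityˡ (+ b) ⟩
            + b                              ∎
        ; small = ℕ.≤-trans (ℕ.≤-reflexive (size-series graph))
                    (ℕ.≤-trans (ℕ.+-monoʳ-≤ 3 small) (size-growth {x = a ℕ.+ b} (ℕ.m≤m+n 3 7) 1≤b)) }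
        where
        open ResistanceCircuit C
        σ-inverse = small-invertible (ℕ.≤-trans 1≤b (ℕ.m≤n+m b a)) a+b<p
        σ = proj₁ σ-inverse
        σ-inv : σ * (+ a + + b) ≈ + 1
        σ-inv = proj₂ σ-inverse
        τ = σ * + a
        τ-inv : τ * (weight + + 1) ≈ + 1
        τ-inv = begin
          σ * + a * (weight + + 1) ≡⟨ expand σ (+ a) weight ⟩
          σ * (weight * + a + + a) ≈⟨ *-congˡ {σ} (+-congʳ {+ a} resistance) ⟩
          σ * (+ b + + a)          ≡⟨ cong (σ *_) (ℤ.+-comm (+ b) (+ a)) ⟩
          σ * (+ a + + b)          ≈⟨ σ-inv ⟩
          + 1                      ∎
          where expand : ∀ σ a r → σ * a * (r + + 1) ≡ σ * (r * a + a)
                expand = solveℤ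
        regroup : ∀ σ a r b → σ * a * r * (a + b) ≡ σ * (a + b) * (r * a)
        regroup = solveℤ

      parallel-step : ∀ {a b} → 1 ≤ a → 2 < p → ResistanceCircuit a b → ResistanceCircuit a (a ℕ.+ b)
      parallel-step {a} {b} 1≤a 2<p C = record
        { graph = parallel (parallel graph) ; weight = weight + η + η
        ; isCircuit = Circuit-resp (laplacian-parallel (parallel graph))
                        (parallel-circuit η η-inv
                          (Circuit-resp (laplacian-parallel graph) (parallel-circuit η η-inv isCircuit)))
        ; resistance = begin
            (weight + η + η) * + a       ≡⟨ regroup weight η (+ a) ⟩
            weight * + a + η * + 2 * + a ≈⟨ +-cong resistance (*-congʳ {+ a} η-inv) ⟩
            + b + + 1 * + a              ≡⟨ cong (λ z → + b + z) (ℤ.*-identityˡ (+ a)) ⟩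
            + b + + a                    ≡⟨ ℤ.+-comm (+ b) (+ a) ⟩
            + a + + b                    ∎
        ; small = ℕ.≤-trans
                    (ℕ.≤-reflexive (≡.trans (size-parallel (parallel graph)) (cong (5 ℕ.+_) (size-parallel graph))))
                    (ℕ.≤-trans (ℕ.+-monoʳ-≤ 10 small)
                      (≡.subst (λ c → 10 ℕ.+ 10 ℕ.* (a ℕ.+ b) ≤ 10 ℕ.* c) (ℕ.+-comm (a ℕ.+ b) a)
                               (size-growth {x = a ℕ.+ b} ℕ.≤-refl 1≤a))) }
        where
        open ResistanceCircuit C
        η-inverse = small-invertible (s≤s z≤n) 2<p
        η = proj₁ η-inverse
        η-inv : η * + 2 ≈ + 1
        η-inv = proj₂ η-inverse
        regroup : ∀ r η a → (r + η + η) * a ≡ r * a + η * + 2 * a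
        regroup = solveℤ

      resistance-circuit : ∀ {a b} → 1 ≤ a → 1 ≤ b → a < p → b < p → ResistanceCircuit a b
      resistance-circuit {a} {b} = go a b (<-wellFounded (a ℕ.+ b))
        where
        go : ∀ a b → Acc _<_ (a ℕ.+ b) → 1 ≤ a → 1 ≤ b → a < p → b < p → ResistanceCircuit a b
        go a b (acc rec) 1≤a 1≤b a<p b<p with ℕ.compare a b
        ... | ℕ.less .a k = ≡.subst (ResistanceCircuit a) (ℕ.+-suc a k)
                (parallel-step 1≤a 2<p (go a (suc k) (rec smaller) 1≤a (s≤s z≤n) a<p k<p))
          where
          smaller : a ℕ.+ suc k < a ℕ.+ suc (a ℕ.+ k)
          smaller = ℕ.+-monoʳ-< a (s≤s (ℕ.m<n+m k 1≤a))
          k<p : suc k < p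
          k<p = ℕ.≤-<-trans (s≤s (ℕ.m≤n+m k a)) b<p
          2<p : 2 < p
          2<p = ℕ.≤-<-trans (s≤s (ℕ.≤-trans 1≤a (ℕ.m≤m+n a k))) b<p
        ... | ℕ.equal .a = unit-edge 1≤a
        ... | ℕ.greater .b k = ≡.subst (λ a → ResistanceCircuit a b) (cong suc (ℕ.+-comm k b))
                (series-step 1≤b k+b<p (go (suc k) b (rec smaller) (s≤s z≤n) 1≤b k<p b<p))
          where
          k+b<p : suc k ℕ.+ b < p
          k+b<p = ≡.subst (_< p) (cong suc (ℕ.+-comm b k)) a<p
          smaller : suc k ℕ.+ b < suc (b ℕ.+ k) ℕ.+ b
          smaller = ≡.subst (_< suc (b ℕ.+ k) ℕ.+ b) (cong suc (ℕ.+-comm b k)) (ℕ.m<m+n (suc (b ℕ.+ k)) 1≤b)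
          k<p : suc k < p
          k<p = ℕ.≤-<-trans (s≤s (ℕ.m≤n+m k b)) a<p

      -- w j ≡ s (mod p), so r w j ≡ r s ≡ j, and j is invertible.
      weight-inverse : ∀ {r s j} w n → r * + s ≈ + j → w ℕ.* j ≡ p ℕ.* n ℕ.+ s → 0 < j → j < p →
                       r * + w ≈ + 1
      weight-inverse {r} {s} {j} w n rs≈j wj≡pn+s 0<j j<p = begin
        r * + w                           ≡⟨ ℤ.*-identityˡ (r * + w) ⟨
        + 1 * (r * + w)                   ≈⟨ *-congʳ {r * + w} (≈-sym σ-inv) ⟩
        σ * + j * (r * + w)               ≡⟨ regroup σ (+ j) r (+ w) ⟩
        σ * r * (+ w * + j)               ≡⟨ cong (λ z → σ * r * z) wj≡pn+s-ℤ ⟩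
        σ * r * (+ p * + n + + s)         ≡⟨ expand σ r (+ p) (+ n) (+ s) ⟩
        σ * (r * + s) + σ * r * + n * + p ≈⟨ +-cong (*-congˡ {σ} rs≈j) (*-congˡ {σ * r * + n} p≈0) ⟩
        σ * + j + σ * r * + n * + 0       ≡⟨ drop (σ * + j) (σ * r * + n) ⟩
        σ * + j                           ≈⟨ σ-inv ⟩
        + 1                               ∎
        where
        σ-inverse = small-invertible 0<j j<p
        σ = proj₁ σ-inverse
        σ-inv : σ * + j ≈ + 1
        σ-inv = proj₂ σ-inverse
        wj≡pn+s-ℤ : + w * + j ≡ + p * + n + + s
        wj≡pn+s-ℤ = ≡.trans (≡.sym (ℤ.pos-* w j))
          (≡.trans (cong +_ wj≡pn+s) (≡.trans (ℤ.pos-+ (p ℕ.* n) s) (cong (_+ + s) (ℤ.pos-* p n))))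
        regroup : ∀ σ j r w → σ * j * (r * w) ≡ σ * r * (w * j)
        regroup = solveℤ
        expand : ∀ σ r p n s → σ * r * (p * n + s) ≡ σ * (r * s) + σ * r * n * p
        expand = solveℤ
        drop : ∀ x y → x + y * + 0 ≡ x
        drop = solveℤ

open import Defs
open import Data.Nat using (ℕ; suc; _+_; _*_; _∸_; _≤_)
open import Data.Nat.Primality using (Prime)
open import Data.Integer using (ℤ; +_) renaming (_*_ to _*ℤ_)
open import Data.Product using (Σ; _×_; _,_)
open import Data.Nat.Properties using (≤-trans; ≤-<-trans; m≤m+n; +-monoʳ-≤)
import Relation.Binary.PropositionalEquality as ≡
open SeriesParallelCircuits using (module Modular; next-multiple; nnz≤size; ≤∸1⇒<; size-budget)

lemma5p13 : Σ ℕ λ C → ∀ (p k i j : ℕ) → Prime p → 1 ≤ k → k ≤ p ∸ 1 →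
    1 ≤ i → i ≤ j → j ≤ k →
    Σ ℕ λ m → Σ (Graph (suc (suc m))) λ G →
    nnz p (laplacian G) ≤ C * k ×
    Σ ℤ λ r → IsCircuitOfWeight p (laplacian G) r ×
    Σ ℕ λ w → p * i ≤ w * j × w * j ≤ p * i + j ×
    (r *ℤ (+ w)) ≡[ p ] (+ 1)
lemma5p13 = 20 , λ p k i j p-prime 1≤k k≤p∸1 1≤i i≤j j≤k →
  let open Modular p
      1≤j = ≤-trans 1≤i i≤j
      j<p = ≤∸1⇒< 1≤j (≤-trans j≤k k≤p∸1)
      (w , s , wj≡pi+s , 1≤s , s≤j) = next-multiple (p * i) j 1≤j
      open ResistanceCircuit (resistance-circuit p-prime 1≤s 1≤j (≤-<-trans s≤j j<p) j<p)
  in internal , graph , ≤-trans (nnz≤size p graph) (≤-trans small (size-budget s≤j j≤k))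
     , weight , circuit⇒isCircuitOfWeight (weight-≉0 resistance 1≤j j<p) isCircuit
     , w , ≡.subst (p * i ≤_) (≡.sym wj≡pi+s) (m≤m+n (p * i) s)
         , ≡.subst (_≤ p * i + j) (≡.sym wj≡pi+s) (+-monoʳ-≤ (p * i) s≤j)
         , ≈⇒≡[p] (weight-inverse p-prime {weight} {s} w i resistance wj≡pi+s 1≤j j<p)
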